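{- For a graph $G$ let $\mathbf{S\Pi}[G]\subseteq\boldsymbol{\Pi}[G]$ be the span of $\{m_\pi:\pi\text{ a stable partition of }G\}$ (equivalently of $\{p_\pi:\pi\text{ stable}\}$). Then $\mathbf{S\Pi}$ is a commutative, cocommutative, self-dual Hopf submonoid of $\boldsymbol{\Pi}$.
   Context: All graphs are finite simple graphs over a field $\mathbb{K}$; $G_S$ is the induced subgraph. Hopf monoids are in graphical species (functors from finite graphs with isomorphisms to $\mathbb{K}$-vector spaces) with respect to the Cauchy product $(\mathbf{g}\cdot\mathbf{h})[G]=\bigoplus_{S|T\models V(G)}\mathbf{g}[G_S]\otimes\mathbf{h}[G_T]$ (ordered pairs of disjoint possibly empty sets with union $V(G)$) and symmetry $x\otimes y\mapsto y\otimes x$. $\boldsymbol{\Pi}[G]$ has basis $\{m_\pi:\pi\vdash V(G)\}$, product $m_\sigma\otimes m_\tau\mapsto m_{\sigma\cup\tau}$, coproduct $m_\pi\mapsto m_{\pi|_S}\otimes m_{\pi|_T}$ ($\pi|_S$ the restriction of the partition to $S$); the $p$ basis is defined by $m_\pi=\sum_{\tau\le\pi}p_\tau$ with $\le$ refinement. A stable partition of $G$ is a set partition of $V(G)$ such that the endpoints of each edge lie in different blocks. Self-dual means isomorphic as a Hopf monoid to its dual. -}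

module Defs where

open import Level using (Level; _⊔_) renaming (suc to lsuc)
open import Data.Bool using (Bool; true; false; T; _∧_; not; if_then_else_)
open import Data.Nat using (ℕ; zero; suc; _≡ᵇ_) renaming (_*_ to _*ℕ_)
open import Data.Fin using (Fin; zero; suc)
open import Data.Vec using (Vec; []; _∷_; lookup; tabulate)
open import Data.List using (List; []; _∷_; map; foldr; concatMap; allFin)
open import Data.Bool.ListAction using (and)
open import Data.List.Relation.Unary.All using (All)
open import Data.Product using (Σ; _×_; _,_; ∃; proj₁; proj₂)
open import Data.Fin.Permutation using (Permutation′; _⟨$⟩ʳ_; _⟨$⟩ˡ_)
open import Relation.Binary.PropositionalEquality using (_≡_; _≢_)
open import Relation.Nullary using (¬_)
open import Algebra.Bundles using (CommutativeRing)

record Field (c ℓ : Level) : Set (lsuc (c ⊔ ℓ)) where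
  field
    commutativeRing : CommutativeRing c ℓ
  open CommutativeRing commutativeRing public
  field
    0≉1     : ¬ (0# ≈ 1#)
    inverse : ∀ x → ¬ (x ≈ 0#) → Σ Carrier λ y → x * y ≈ 1#

-- Finite simple graphs on the vertex set Fin n.
-- (Every finite graph is isomorphic to one of these; graph isomorphisms
--  between them are permutations of Fin n preserving adjacency.)

record Graph (n : ℕ) : Set where
  field
    adj   : Fin n → Fin n → Bool
    sym   : ∀ i j → adj i j ≡ adj j i
    irrefl : ∀ i → adj i i ≡ false
open Graph public

IsGraphIso : ∀ {n} → Graph n → Graph n → Permutation′ n → Set
IsGraphIso G G' ρ = ∀ i j → adj G' (ρ ⟨$⟩ʳ i) (ρ ⟨$⟩ʳ j) ≡ adj G i j

-- Decompositions S|T ⊨ V(G) (ordered, S and T possibly empty), with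
-- |S| = k and |T| = l.  S and T are identified with Fin k and Fin l via
-- the order-preserving enumerations embL / embR.

data Split : ℕ → ℕ → ℕ → Set where
  []    : Split 0 0 0
  left  : ∀ {n k l} → Split n k l → Split (suc n) (suc k) l
  right : ∀ {n k l} → Split n k l → Split (suc n) k (suc l)

flip : ∀ {n k l} → Split n k l → Split n l k
flip []        = []
flip (left s)  = right (flip s)
flip (right s) = left (flip s)

embL : ∀ {n k l} → Split n k l → Fin k → Fin n
embL (left s)  zero    = zero
embL (left s)  (suc i) = suc (embL s i)
embL (right s) i       = suc (embL s i)

embR : ∀ {n k l} → Split n k l → Fin l → Fin n
embR (left s)  i       = suc (embR s i)
embR (right s) zero    = zero
embR (right s) (suc i) = suc (embR s i)

induce : ∀ {n m} → (Fin m → Fin n) → Graph n → Graph m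
induce e G = record
  { adj    = λ i j → adj G (e i) (e j)
  ; sym    = λ i j → sym G (e i) (e j)
  ; irrefl = λ i → irrefl G (e i) }

GL : ∀ {n k l} → Split n k l → Graph n → Graph k
GL s = induce (embL s)

GR : ∀ {n k l} → Split n k l → Graph n → Graph l
GR s = induce (embR s)

-- Set partitions of Fin n, presented by block labellings: the partition
-- of a labelling α has blocks the nonempty fibres of α.  Two labellings
-- present the same partition iff α ~ β.

Lab : ℕ → Set
Lab n = Vec ℕ n

_~ᵇ_ : ∀ {n} → Lab n → Lab n → Bool
_~ᵇ_ {n} α β = and (concatMap (λ i → map (λ j →
  eqB (lookup α i ≡ᵇ lookup α j) (lookup β i ≡ᵇ lookup β j)) (allFin n)) (allFin n))
  where
  eqB : Bool → Bool → Bool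
  eqB true  b = b
  eqB false b = not b

_~_ : ∀ {n} → Lab n → Lab n → Set
α ~ β = T (α ~ᵇ β)

Stable : ∀ {n} → Graph n → Lab n → Set
Stable G α = ∀ i j → T (adj G i j) → lookup α i ≢ lookup α j

restrL : ∀ {n k l} → Split n k l → Lab n → Lab k
restrL s π = tabulate (λ i → lookup π (embL s i))

restrR : ∀ {n k l} → Split n k l → Lab n → Lab l
restrR s π = tabulate (λ i → lookup π (embR s i))

-- union σ ∪ τ of a partition of S and a partition of T
-- (labels made disjoint: 2a on S, 2b+1 on T)
union : ∀ {n k l} → Split n k l → Lab k → Lab l → Lab n
union []        []      []      = []
union (left s)  (a ∷ σ) τ       = (2 *ℕ a) ∷ union s σ τ
union (right s) σ       (b ∷ τ) = suc (2 *ℕ b) ∷ union s σ τ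

relabel : ∀ {n} → Permutation′ n → Lab n → Lab n
relabel ρ α = tabulate (λ j → lookup α (ρ ⟨$⟩ˡ j))

module _ {c ℓ} (K : Field c ℓ) where
  open Field K

  -- Π[G] for G on Fin n: the K-vector space with basis {m_π}, presented
  -- by finite formal sums Σ c·m_π ;  equality compares coefficients.
  FSum : ℕ → Set c
  FSum n = List (Carrier × Lab n)

  -- Π[G_S] ⊗ Π[G_T] : formal sums of basis tensors m_σ ⊗ m_τ
  TSum : ℕ → ℕ → Set c
  TSum k l = List (Carrier × Lab k × Lab l)

  coeff : ∀ {n} → Lab n → FSum n → Carrier
  coeff π = foldr (λ { (a , α) r → if α ~ᵇ π then a + r else r }) 0#

  coeffT : ∀ {k l} → Lab k → Lab l → TSum k l → Carrier
  coeffT σ τ = foldr (λ { (a , α , β) r → if (α ~ᵇ σ) ∧ (β ~ᵇ τ) then a + r else r }) 0#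

  _≋_ : ∀ {n} → FSum n → FSum n → Set ℓ
  x ≋ y = ∀ π → coeff π x ≈ coeff π y

  _≋ᵀ_ : ∀ {k l} → TSum k l → TSum k l → Set ℓ
  w ≋ᵀ u = ∀ σ τ → coeffT σ τ w ≈ coeffT σ τ u

  _⊗_ : ∀ {k l} → FSum k → FSum l → TSum k l
  x ⊗ y = concatMap (λ { (a , σ) → map (λ { (b , τ) → (a * b , σ , τ) }) y }) x

  swapT : ∀ {k l} → TSum k l → TSum l k
  swapT = map (λ { (a , σ , τ) → (a , τ , σ) })

  μ : ∀ {n k l} → Split n k l → TSum k l → FSum n
  μ s = map (λ { (a , σ , τ) → (a , union s σ τ) })

  Δ : ∀ {n k l} → Split n k l → FSum n → TSum k l
  Δ s = map (λ { (a , π) → (a , restrL s π , restrR s π) })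

  η : Carrier → FSum 0
  η a = (a , []) ∷ []

  ε : FSum 0 → Carrier
  ε = foldr (λ { (a , _) r → a + r }) 0#

  AllStable : ∀ {n} → Graph n → FSum n → Set c
  AllStable G x = All (λ p → Stable G (proj₂ p)) x

  InSΠ : ∀ {n} → Graph n → FSum n → Set (c ⊔ ℓ)
  InSΠ G x = Σ (FSum _) λ y → AllStable G y × (x ≋ y)

  AllStableT : ∀ {k l} → Graph k → Graph l → TSum k l → Set c
  AllStableT G H w = All (λ p → Stable G (proj₁ (proj₂ p)) × Stable H (proj₂ (proj₂ p))) w

  InSΠ⊗SΠ : ∀ {k l} → Graph k → Graph l → TSum k l → Set (c ⊔ ℓ)
  InSΠ⊗SΠ G H w = Σ (TSum _ _) λ u → AllStableT G H u × (w ≋ᵀ u)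

  -- (1) SΠ is a Hopf submonoid of Π: closed under unit, product and
  -- coproduct (being connected, it is then automatically Hopf and
  -- closed under the antipode).
  IsHopfSubmonoid : Set (c ⊔ ℓ)
  IsHopfSubmonoid =
      (∀ (G : Graph 0) → InSΠ G (η 1#))
    × (∀ {n k l} (G : Graph n) (s : Split n k l) (w : TSum k l) →
         InSΠ⊗SΠ (GL s G) (GR s G) w → InSΠ G (μ s w))
    × (∀ {n k l} (G : Graph n) (s : Split n k l) (z : FSum n) →
         InSΠ G z → InSΠ⊗SΠ (GL s G) (GR s G) (Δ s z))

  IsCommutative : Set (c ⊔ ℓ)
  IsCommutative = ∀ {n k l} (G : Graph n) (s : Split n k l) (w : TSum k l) →
    AllStableT (GL s G) (GR s G) w → μ (flip s) (swapT w) ≋ μ s w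

  IsCocommutative : Set (c ⊔ ℓ)
  IsCocommutative = ∀ {n k l} (G : Graph n) (s : Split n k l) (z : FSum n) →
    AllStable G z → swapT (Δ s z) ≋ᵀ Δ (flip s) z

  -- (4) self-duality.
  -- A family of linear maps φ_G : SΠ[G] → SΠ*[G] is given by its matrix
  -- M G σ π = φ_G(m_σ)(m_π) on stable σ, π; then φ_G(x)(y) = ev M x y.
  Mat : Set c
  Mat = ∀ {n} → Graph n → Lab n → Lab n → Carrier

  ev : ∀ {n} → (Lab n → Lab n → Carrier) → FSum n → FSum n → Carrier
  ev M x y = foldr (λ { (a , σ) r → foldr (λ { (b , π) r' → (a * b) * M σ π + r' }) 0# y + r }) 0# x

  -- (φ ⊗ φ)(w) evaluated on u ∈ SΠ[G_S] ⊗ SΠ[G_T]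
  evT : ∀ {k l} → (Lab k → Lab k → Carrier) → (Lab l → Lab l → Carrier) →
        TSum k l → TSum k l → Carrier
  evT M N w u = foldr (λ { (a , σ , τ) r → foldr (λ { (b , σ' , τ') r' →
    (a * b) * (M σ σ' * N τ τ') + r' }) 0# u + r }) 0# w

  IsSelfDualIso : Mat → Set (c ⊔ ℓ)
  IsSelfDualIso M =
      (∀ {n} (G : Graph n) (σ σ' π π' : Lab n) → Stable G σ → Stable G π →
         σ ~ σ' → π ~ π' → M G σ π ≈ M G σ' π')
    × (∀ {n} (G G' : Graph n) (ρ : Permutation′ n) → IsGraphIso G G' ρ →
         ∀ σ π → Stable G σ → Stable G π →
         M G' (relabel ρ σ) (relabel ρ π) ≈ M G σ π)
    -- each φ_G is injective
    × (∀ {n} (G : Graph n) (x : FSum n) → AllStable G x →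
         (∀ y → AllStable G y → ev (M G) x y ≈ 0#) → x ≋ [])
    -- each φ_G is surjective onto SΠ*[G]
    × (∀ {n} (G : Graph n) (f : Lab n → Carrier) →
         (∀ π π' → Stable G π → π ~ π' → f π ≈ f π') →
         Σ (FSum n) λ x → AllStable G x ×
           (∀ π → Stable G π → ev (M G) x ((1# , π) ∷ []) ≈ f π))
    -- φ ∘ μ_{S,T} = μ*_{S,T} ∘ (φ ⊗ φ)
    × (∀ {n k l} (G : Graph n) (s : Split n k l) (w : TSum k l) (z : FSum n) →
         AllStableT (GL s G) (GR s G) w → AllStable G z →
         ev (M G) (μ s w) z ≈ evT (M (GL s G)) (M (GR s G)) w (Δ s z))
    -- Δ*_{S,T} ∘ φ = (φ ⊗ φ) ∘ Δ_{S,T}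
    × (∀ {n k l} (G : Graph n) (s : Split n k l) (z : FSum n) (u : TSum k l) →
         AllStable G z → AllStableT (GL s G) (GR s G) u →
         ev (M G) z (μ s u) ≈ evT (M (GL s G)) (M (GR s G)) (Δ s z) u)
    -- φ ∘ unit = dual unit (= counit)  and  dual counit ∘ φ = counit
    × (∀ (G : Graph 0) (z : FSum 0) → AllStable G z →
         (ev (M G) (η 1#) z ≈ ε z) × (ev (M G) z (η 1#) ≈ ε z))

  IsSelfDual : Set (c ⊔ ℓ)
  IsSelfDual = Σ Mat IsSelfDualIso

-- Set partitions are encoded as block labellings up to ≅ (same blocks).  A refinement of a stable
-- partition, its restrictions to S and T, and the union of stable partitions of G_S and G_T are
-- stable, so SΠ is closed under μ and Δ; coefficients are compared up to ≅, on which μ and Δ act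
-- compatibly.  Commutativity and cocommutativity already hold for labellings up to ≅.
-- For self-duality pair m_σ with m_π by the number of common refinements of σ and π, which makes
-- the p-basis (m_σ = Σ_{α ⊑ σ} p_α) orthonormal.  The pairing is compatible with μ and Δ because
-- the partitions below σ ∪ τ are exactly the unions of partitions below σ and below τ.  Stable
-- partitions form a down-set, so on them the pairing is ζᵀζ with ζ unitriangular, hence invertible
-- over any field: both triangular systems are solved by induction on the number of ordered pairs of
-- points sharing a block.

module Submission where

open import Defs hiding (sym)
open import Data.Bool using (Bool; true; false; T; T?; _∧_; if_then_else_)
open import Data.Bool.Properties using (T-∧)
open import Data.Fin using (Fin; zero; suc)
open import Data.List using (List; []; _∷_; _++_; map; foldr; concatMap; downFrom; filter)
open import Data.List.Relation.Unary.All as All using (All; []; _∷_)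
import Data.List.Relation.Unary.All.Properties as All
open import Data.Nat using (ℕ; zero; suc)
open import Data.Product using (Σ; ∃; _×_; _,_; proj₁; proj₂)
open import Data.Unit using (tt)
open import Data.Vec using (Vec; []; _∷_; lookup)
open import Function using (_∘_; _⇔_; mk⇔; Equivalence)
open import Relation.Nullary using (Dec; yes; no; ¬_; contradiction)
open import Relation.Nullary.Decidable using (_×-dec_; ¬?)
import Data.Fin.Permutation as P

private variable
  n k l : ℕ

module Partitions where

  open import Data.Bool.ListAction using (and)
  open import Data.Fin using (toℕ)
  open import Data.Fin.Properties using (all?; ¬∀⟶∃¬; toℕ-injective; toℕ<n)
  open import Data.List using (allFin)
  open import Data.Nat using (_≡ᵇ_; _<_; _≤_; _*_; _+_; _∸_; z≤n; s≤s)
  open import Data.Nat.Properties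
    using ( _≟_; suc-injective; ≡ᵇ⇒≡; ≡⇒≡ᵇ; ≤-refl; +-mono-≤; +-mono-<-≤; +-mono-≤-<
          ; *-cancelˡ-≡; even≢odd; *-identityʳ; ∸-monoʳ-<; m∸n≤m)
  open import Data.Vec using () renaming (map to mapᵥ)
  open import Data.Vec.Properties using (lookup∘tabulate; lookup-map; tabulate-cong; tabulate∘lookup; ≡-dec)
  open import Relation.Binary.PropositionalEquality
  open import Relation.Nullary.Decidable using (map′; _→-dec_)
  open P using (Permutation′)

  infix 4 _⊑_ _⊏_ _≅_

  record _⊑_ (α β : Lab n) : Set where
    constructor refines
    field merge : ∀ i j → lookup α i ≡ lookup α j → lookup β i ≡ lookup β j
  open _⊑_ public

  _≅_ : Lab n → Lab n → Set
  α ≅ β = α ⊑ β × β ⊑ α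

  _⊏_ : Lab n → Lab n → Set
  α ⊏ β = α ⊑ β × ¬ β ⊑ α

  ⊑-refl : (α : Lab n) → α ⊑ α
  ⊑-refl α = refines λ i j e → e

  ⊑-trans : {α β γ : Lab n} → α ⊑ β → β ⊑ γ → α ⊑ γ
  ⊑-trans p q = refines λ i j e → merge q i j (merge p i j e)

  ≅-refl : (α : Lab n) → α ≅ α
  ≅-refl α = ⊑-refl α , ⊑-refl α

  ≅-sym : {α β : Lab n} → α ≅ β → β ≅ α
  ≅-sym (p , q) = q , p

  ≅-trans : {α β γ : Lab n} → α ≅ β → β ≅ γ → α ≅ γ
  ≅-trans (p , q) (p′ , q′) = ⊑-trans p p′ , ⊑-trans q′ q

  _⊑?_ : (α β : Lab n) → Dec (α ⊑ β)
  α ⊑? β = map′ refines merge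
    (all? λ i → all? λ j → (lookup α i ≟ lookup α j) →-dec (lookup β i ≟ lookup β j))

  _≅?_ : (α β : Lab n) → Dec (α ≅ β)
  α ≅? β = (α ⊑? β) ×-dec (β ⊑? α)

  _⊏?_ : (α β : Lab n) → Dec (α ⊏ β)
  α ⊏? β = (α ⊑? β) ×-dec ¬? (β ⊑? α)

  ≅-pointwise : {α β : Lab n} →
    (∀ i j → lookup α i ≡ lookup α j ⇔ lookup β i ≡ lookup β j) → α ≅ β
  ≅-pointwise h = refines (λ i j → Equivalence.to (h i j)) , refines (λ i j → Equivalence.from (h i j))

  T-and : {bs : List Bool} → T (and bs) ⇔ All T bs
  T-and = mk⇔ to from
    where
    to : ∀ {bs} → T (and bs) → All T bs
    to {[]}        _ = []
    to {true ∷ bs} t = tt ∷ to t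
    from : ∀ {bs} → All T bs → T (and bs)
    from []                  = tt
    from {true ∷ _} (_ ∷ ts) = from ts

  T-and-grid : (g : Fin n → Fin n → Bool) →
    T (and (concatMap (λ i → map (g i) (allFin n)) (allFin n))) ⇔ (∀ i j → T (g i j))
  T-and-grid {n} g = mk⇔
    (λ t i j → All.tabulate⁻ (All.map⁻ (All.tabulate⁻ (All.map⁻ {xs = allFin n}
                 (All.concat⁻ (Equivalence.to T-and t))) i)) j)
    (λ h → Equivalence.from T-and (All.concat⁺ (All.map⁺ (All.tabulate⁺ λ i → All.map⁺ (All.tabulate⁺ (h i))))))

  grid-false : (g : Fin n → Fin n → Bool) →
    and (concatMap (λ i → map (g i) (allFin n)) (allFin n)) ≡ false → ∃ λ i → ∃ λ j → g i j ≡ false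
  grid-false {n} g e with all? (λ i → all? (λ j → T? (g i j)))
  ... | yes all = contradiction (Equivalence.from (T-and-grid g) all) (λ t → subst T e t)
  ... | no ¬all with ¬∀⟶∃¬ n _ (λ i → all? (λ j → T? (g i j))) ¬all
  ... | i , ¬i with ¬∀⟶∃¬ n _ (λ j → T? (g i j)) ¬i
  ... | j , ¬j = i , j , ¬T⇒≡false ¬j
    where
    ¬T⇒≡false : ∀ {b} → ¬ T b → b ≡ false
    ¬T⇒≡false {false} _ = refl
    ¬T⇒≡false {true}  f = contradiction tt f

  T-~ᵇ : {α β : Lab n} → T (α ~ᵇ β) ⇔ α ≅ β
  T-~ᵇ {n} {α} {β} = mk⇔ (λ t → ≅-pointwise (sound t)) (λ { (p , q) → complete p q })
    where
    false-≢ : ∀ {a b} → (a ≡ᵇ b) ≡ false → a ≢ b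
    false-≢ {a} {b} e a≡b = subst T e (≡⇒≡ᵇ a b a≡b)
    true-≡ : ∀ {a b} → (a ≡ᵇ b) ≡ true → a ≡ b
    true-≡ {a} {b} e = ≡ᵇ⇒≡ a b (subst T (sym e) tt)
    sound : T (α ~ᵇ β) → ∀ i j → lookup α i ≡ lookup α j ⇔ lookup β i ≡ lookup β j
    sound t i j with lookup α i ≡ᵇ lookup α j in eα | lookup β i ≡ᵇ lookup β j in eβ
                   | Equivalence.to (T-and-grid _) t i j
    ... | true  | true  | _  = mk⇔ (λ _ → true-≡ eβ) (λ _ → true-≡ eα)
    ... | false | false | _  = mk⇔ (λ e → contradiction e (false-≢ eα)) (λ e → contradiction e (false-≢ eβ))
    ... | true  | false | ()
    ... | false | true  | ()
    complete : α ⊑ β → β ⊑ α → T (α ~ᵇ β)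
    complete p q with α ~ᵇ β in e
    ... | true  = tt
    ... | false with grid-false _ e
    ... | i , j , gij with lookup α i ≡ᵇ lookup α j in eα | lookup β i ≡ᵇ lookup β j in eβ | gij
    ... | true  | false | _  = contradiction (merge p i j (true-≡ eα)) (false-≢ eβ)
    ... | false | true  | _  = contradiction (merge q i j (true-≡ eβ)) (false-≢ eα)
    ... | true  | true  | ()
    ... | false | false | ()

  lookup-extensionality : {v w : Vec ℕ n} → (∀ i → lookup v i ≡ lookup w i) → v ≡ w
  lookup-extensionality {v = v} {w} h =
    trans (sym (tabulate∘lookup v)) (trans (tabulate-cong h) (tabulate∘lookup w))

  firstIndex : Vec ℕ n → ℕ → ℕ
  firstIndex []       x = 0
  firstIndex (y ∷ ys) x with y ≟ x
  ... | yes _ = 0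
  ... | no  _ = suc (firstIndex ys x)

  firstIndex-cong : (α β : Vec ℕ n) {x y : ℕ} → (∀ j → lookup α j ≡ x ⇔ lookup β j ≡ y) →
    firstIndex α x ≡ firstIndex β y
  firstIndex-cong []      []      h = refl
  firstIndex-cong (a ∷ α) (b ∷ β) {x} {y} h with a ≟ x | b ≟ y
  ... | yes _   | yes _   = refl
  ... | no  _   | no  _   = cong suc (firstIndex-cong α β (λ j → h (suc j)))
  ... | yes a≡x | no  b≢y = contradiction (Equivalence.to (h zero) a≡x) b≢y
  ... | no  a≢x | yes b≡y = contradiction (Equivalence.from (h zero) b≡y) a≢x

  firstIndex-found : (α : Vec ℕ n) (i : Fin n) →
    ∃ λ k → toℕ k ≡ firstIndex α (lookup α i) × lookup α k ≡ lookup α i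
  firstIndex-found α i = go α i refl
    where
    go : ∀ {n} (α : Vec ℕ n) {x} (i : Fin n) → lookup α i ≡ x →
         ∃ λ k → toℕ k ≡ firstIndex α x × lookup α k ≡ x
    go (a ∷ α) {x} i e with a ≟ x
    go (a ∷ α) i       e | yes a≡x = zero , refl , a≡x
    go (a ∷ α) zero    e | no  a≢x = contradiction e a≢x
    go (a ∷ α) (suc i) e | no  a≢x with go α i e
    ... | k , p , q = suc k , cong suc p , q

  canon : Lab n → Lab n
  canon α = mapᵥ (firstIndex α) α

  lookup-canon : (α : Lab n) (i : Fin n) → lookup (canon α) i ≡ firstIndex α (lookup α i)
  lookup-canon α i = lookup-map i (firstIndex α) α

  canon-≅ : (α : Lab n) → α ≅ canon α
  canon-≅ α = ≅-pointwise λ i j → mk⇔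
    (λ e → trans (lookup-canon α i) (trans (cong (firstIndex α) e) (sym (lookup-canon α j))))
    (λ e → same i j (trans (sym (lookup-canon α i)) (trans e (lookup-canon α j))))
    where
    same : ∀ i j → firstIndex α (lookup α i) ≡ firstIndex α (lookup α j) → lookup α i ≡ lookup α j
    same i j e with firstIndex-found α i | firstIndex-found α j
    ... | k , p , q | k′ , p′ , q′ =
      trans (sym q) (trans (cong (lookup α) (toℕ-injective (trans p (trans e (sym p′))))) q′)

  canon-cong : {α β : Lab n} → α ≅ β → canon α ≡ canon β
  canon-cong {α = α} {β} (p , q) = lookup-extensionality λ i → begin
    lookup (canon α) i              ≡⟨ lookup-canon α i ⟩
    firstIndex α (lookup α i)       ≡⟨ firstIndex-cong α β (λ j → mk⇔ (merge p j i) (merge q j i)) ⟩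
    firstIndex β (lookup β i)       ≡⟨ lookup-canon β i ⟨
    lookup (canon β) i              ∎
    where open ≡-Reasoning

  canon-< : (α : Lab n) (i : Fin n) → lookup (canon α) i < n
  canon-< α i with firstIndex-found α i
  ... | k , p , _ = subst (_< _) (trans p (sym (lookup-canon α i))) (toℕ<n k)

  IsCanonical : Lab n → Set
  IsCanonical α = canon α ≡ α

  canonical? : (α : Lab n) → Dec (IsCanonical α)
  canonical? α = ≡-dec _≟_ (canon α) α

  canon-canonical : (α : Lab n) → IsCanonical (canon α)
  canon-canonical α = sym (canon-cong (canon-≅ α))

  canonical-≅⇔≡canon : {v u : Lab n} → (IsCanonical v × v ≅ u) ⇔ (v ≡ canon u)
  canonical-≅⇔≡canon {u = u} = mk⇔
    (λ { (c , e) → trans (sym c) (canon-cong e) })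
    (λ { refl → canon-canonical u , ≅-sym (canon-≅ u) })

  vectors : ℕ → (n : ℕ) → List (Vec ℕ n)
  vectors m zero    = [] ∷ []
  vectors m (suc n) = concatMap (λ a → map (a ∷_) (vectors m n)) (downFrom m)

  ∑ℕ : (Fin n → ℕ) → ℕ
  ∑ℕ {zero}  f = 0
  ∑ℕ {suc n} f = f zero + ∑ℕ (λ i → f (suc i))

  ∑ℕ-mono-≤ : (f g : Fin n → ℕ) → (∀ i → f i ≤ g i) → ∑ℕ f ≤ ∑ℕ g
  ∑ℕ-mono-≤ {zero}  f g h = z≤n
  ∑ℕ-mono-≤ {suc n} f g h = +-mono-≤ (h zero) (∑ℕ-mono-≤ _ _ (λ i → h (suc i)))

  ∑ℕ-mono-< : (f g : Fin n → ℕ) → (∀ i → f i ≤ g i) → (k : Fin n) → f k < g k → ∑ℕ f < ∑ℕ g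
  ∑ℕ-mono-< {suc n} f g h zero    lt = +-mono-<-≤ lt (∑ℕ-mono-≤ _ _ (λ i → h (suc i)))
  ∑ℕ-mono-< {suc n} f g h (suc k) lt = +-mono-≤-< (h zero) (∑ℕ-mono-< _ _ (λ i → h (suc i)) k lt)

  ∑ℕ-≤ : (f : Fin n → ℕ) (b : ℕ) → (∀ i → f i ≤ b) → ∑ℕ f ≤ n * b
  ∑ℕ-≤ {zero}  f b h = z≤n
  ∑ℕ-≤ {suc n} f b h = +-mono-≤ (h zero) (∑ℕ-≤ _ b (λ i → h (suc i)))

  indicator : {A : Set} → Dec A → ℕ
  indicator (yes _) = 1
  indicator (no  _) = 0

  indicator-mono : {A B : Set} (a? : Dec A) (b? : Dec B) → (A → B) → indicator a? ≤ indicator b?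
  indicator-mono (yes a) (yes _) f = ≤-refl
  indicator-mono (yes a) (no ¬b) f = contradiction (f a) ¬b
  indicator-mono (no _)  _       f = z≤n

  blockPairs : Lab n → ℕ
  blockPairs α = ∑ℕ λ i → ∑ℕ λ j → indicator (lookup α i ≟ lookup α j)

  blockPairs-≤ : (α : Lab n) → blockPairs α ≤ n * n
  blockPairs-≤ {n} α = ∑ℕ-≤ _ n λ i →
    subst (∑ℕ (λ j → indicator (lookup α i ≟ lookup α j)) ≤_) (*-identityʳ n)
          (∑ℕ-≤ _ 1 λ j → indicator-≤1 (lookup α i ≟ lookup α j))
    where
    indicator-≤1 : {A : Set} (a? : Dec A) → indicator a? ≤ 1
    indicator-≤1 (yes _) = ≤-refl
    indicator-≤1 (no  _) = z≤n

  ⋢-witness : {α β : Lab n} → ¬ β ⊑ α →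
    ∃ λ i → ∃ λ j → lookup β i ≡ lookup β j × lookup α i ≢ lookup α j
  ⋢-witness {n} {α} {β} β⋢α
    with ¬∀⟶∃¬ n _ (λ i → all? λ j → (lookup β i ≟ lookup β j) →-dec (lookup α i ≟ lookup α j))
                  (λ h → β⋢α (refines h))
  ... | i , ¬i with ¬∀⟶∃¬ n _ (λ j → (lookup β i ≟ lookup β j) →-dec (lookup α i ≟ lookup α j)) ¬i
  ... | j , ¬j with lookup β i ≟ lookup β j | lookup α i ≟ lookup α j
  ... | no  β≢  | _      = contradiction (λ e → contradiction e β≢) ¬j
  ... | yes _   | yes α≡ = contradiction (λ _ → α≡) ¬j
  ... | yes β≡  | no α≢  = i , j , β≡ , α≢

  blockPairs-mono-< : {α β : Lab n} → α ⊏ β → blockPairs α < blockPairs β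
  blockPairs-mono-< {n} {α} {β} (α⊑β , β⋢α) with ⋢-witness β⋢α
  ... | i , j , β≡ , α≢ =
    ∑ℕ-mono-< _ _ (λ i → ∑ℕ-mono-≤ _ _ (pointwise i)) i
      (∑ℕ-mono-< _ _ (pointwise i) j (indicator-< (lookup α i ≟ lookup α j) (lookup β i ≟ lookup β j) α≢ β≡))
    where
    pointwise : ∀ i j → indicator (lookup α i ≟ lookup α j) ≤ indicator (lookup β i ≟ lookup β j)
    pointwise i j = indicator-mono _ _ (merge α⊑β i j)
    indicator-< : {A B : Set} (a? : Dec A) (b? : Dec B) → ¬ A → B → indicator a? < indicator b?
    indicator-< (no _)  (yes _) ¬a b = s≤s z≤n
    indicator-< (yes a) _       ¬a b = contradiction a ¬a
    indicator-< _       (no ¬b) ¬a b = contradiction b ¬b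

  coBlockPairs : Lab n → ℕ
  coBlockPairs {n} α = n * n ∸ blockPairs α

  coBlockPairs-mono-< : {α β : Lab n} → α ⊏ β → coBlockPairs β < coBlockPairs α
  coBlockPairs-mono-< {β = β} α⊏β = ∸-monoʳ-< (blockPairs-mono-< α⊏β) (blockPairs-≤ β)

  coBlockPairs-≤ : (α : Lab n) → coBlockPairs α ≤ n * n
  coBlockPairs-≤ {n} α = m∸n≤m (n * n) (blockPairs α)

  data Side (s : Split n k l) : Fin n → Set where
    onL : (i : Fin k) → Side s (embL s i)
    onR : (j : Fin l) → Side s (embR s j)

  side : (s : Split n k l) (v : Fin n) → Side s v
  side (left s)  zero    = onL zero
  side (left s)  (suc v) with side s v
  ... | onL i = onL (suc i)
  ... | onR j = onR j
  side (right s) zero    = onR zero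
  side (right s) (suc v) with side s v
  ... | onL i = onL i
  ... | onR j = onR (suc j)

  lookup-union-embL : (s : Split n k l) (σ : Lab k) (τ : Lab l) (i : Fin k) →
    lookup (union s σ τ) (embL s i) ≡ 2 * lookup σ i
  lookup-union-embL (left s)  (a ∷ σ) τ zero    = refl
  lookup-union-embL (left s)  (a ∷ σ) τ (suc i) = lookup-union-embL s σ τ i
  lookup-union-embL (right s) σ (b ∷ τ) i       = lookup-union-embL s σ τ i

  lookup-union-embR : (s : Split n k l) (σ : Lab k) (τ : Lab l) (j : Fin l) →
    lookup (union s σ τ) (embR s j) ≡ suc (2 * lookup τ j)
  lookup-union-embR (left s)  (a ∷ σ) τ j       = lookup-union-embR s σ τ j
  lookup-union-embR (right s) σ (b ∷ τ) zero    = refl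
  lookup-union-embR (right s) σ (b ∷ τ) (suc j) = lookup-union-embR s σ τ j

  module _ (s : Split n k l) (σ : Lab k) (τ : Lab l) where

    union-sameˡ : ∀ i j →
      lookup (union s σ τ) (embL s i) ≡ lookup (union s σ τ) (embL s j) ⇔ lookup σ i ≡ lookup σ j
    union-sameˡ i j = mk⇔
      (λ e → *-cancelˡ-≡ (lookup σ i) _ 2
        (trans (sym (lookup-union-embL s σ τ i)) (trans e (lookup-union-embL s σ τ j))))
      (λ e → trans (lookup-union-embL s σ τ i) (trans (cong (2 *_) e) (sym (lookup-union-embL s σ τ j))))

    union-sameʳ : ∀ i j →
      lookup (union s σ τ) (embR s i) ≡ lookup (union s σ τ) (embR s j) ⇔ lookup τ i ≡ lookup τ j
    union-sameʳ i j = mk⇔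
      (λ e → *-cancelˡ-≡ (lookup τ i) _ 2 (suc-injective
        (trans (sym (lookup-union-embR s σ τ i)) (trans e (lookup-union-embR s σ τ j)))))
      (λ e → trans (lookup-union-embR s σ τ i)
        (trans (cong (λ a → suc (2 * a)) e) (sym (lookup-union-embR s σ τ j))))

    union-apart : ∀ i j → lookup (union s σ τ) (embL s i) ≢ lookup (union s σ τ) (embR s j)
    union-apart i j e =
      even≢odd (lookup σ i) (lookup τ j)
        (trans (sym (lookup-union-embL s σ τ i)) (trans e (lookup-union-embR s σ τ j)))

  lookup-restrL : (s : Split n k l) (π : Lab n) (i : Fin k) → lookup (restrL s π) i ≡ lookup π (embL s i)
  lookup-restrL s π = lookup∘tabulate _

  lookup-restrR : (s : Split n k l) (π : Lab n) (j : Fin l) → lookup (restrR s π) j ≡ lookup π (embR s j)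
  lookup-restrR s π = lookup∘tabulate _

  restrL-⊑ : (s : Split n k l) {α β : Lab n} → α ⊑ β → restrL s α ⊑ restrL s β
  restrL-⊑ s {α} {β} p = refines λ i j e → trans (lookup-restrL s β i) (trans
    (merge p _ _ (trans (sym (lookup-restrL s α i)) (trans e (lookup-restrL s α j)))) (sym (lookup-restrL s β j)))

  restrR-⊑ : (s : Split n k l) {α β : Lab n} → α ⊑ β → restrR s α ⊑ restrR s β
  restrR-⊑ s {α} {β} p = refines λ i j e → trans (lookup-restrR s β i) (trans
    (merge p _ _ (trans (sym (lookup-restrR s α i)) (trans e (lookup-restrR s α j)))) (sym (lookup-restrR s β j)))

  restrL-≅ : (s : Split n k l) {α β : Lab n} → α ≅ β → restrL s α ≅ restrL s β
  restrL-≅ s (p , q) = restrL-⊑ s p , restrL-⊑ s q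

  restrR-≅ : (s : Split n k l) {α β : Lab n} → α ≅ β → restrR s α ≅ restrR s β
  restrR-≅ s (p , q) = restrR-⊑ s p , restrR-⊑ s q

  restrL-union : (s : Split n k l) (σ : Lab k) (τ : Lab l) → restrL s (union s σ τ) ≅ σ
  restrL-union s σ τ = ≅-pointwise λ i j → subst₂ (λ a b → a ≡ b ⇔ _)
    (sym (lookup-restrL s (union s σ τ) i)) (sym (lookup-restrL s (union s σ τ) j)) (union-sameˡ s σ τ i j)

  restrR-union : (s : Split n k l) (σ : Lab k) (τ : Lab l) → restrR s (union s σ τ) ≅ τ
  restrR-union s σ τ = ≅-pointwise λ i j → subst₂ (λ a b → a ≡ b ⇔ _)
    (sym (lookup-restrR s (union s σ τ) i)) (sym (lookup-restrR s (union s σ τ) j)) (union-sameʳ s σ τ i j)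

  data Together (s : Split n k l) (σ : Lab k) (τ : Lab l) : Fin n → Fin n → Set where
    bothL : ∀ {i j} → lookup σ i ≡ lookup σ j → Together s σ τ (embL s i) (embL s j)
    bothR : ∀ {i j} → lookup τ i ≡ lookup τ j → Together s σ τ (embR s i) (embR s j)

  union-together : (s : Split n k l) (σ : Lab k) (τ : Lab l) {v w : Fin n} →
    lookup (union s σ τ) v ≡ lookup (union s σ τ) w → Together s σ τ v w
  union-together s σ τ {v} {w} e with side s v | side s w
  ... | onL i | onL j = bothL (Equivalence.to (union-sameˡ s σ τ i j) e)
  ... | onR i | onR j = bothR (Equivalence.to (union-sameʳ s σ τ i j) e)
  ... | onL i | onR j = contradiction e (union-apart s σ τ i j)
  ... | onR i | onL j = contradiction (sym e) (union-apart s σ τ j i)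

  union-⊑ : (s : Split n k l) {σ : Lab k} {τ : Lab l} {π : Lab n} →
    union s σ τ ⊑ π ⇔ (σ ⊑ restrL s π × τ ⊑ restrR s π)
  union-⊑ s {σ} {τ} {π} = mk⇔
    (λ p → refines (λ i j e → trans (lookup-restrL s π i) (trans
              (merge p _ _ (Equivalence.from (union-sameˡ s σ τ i j) e)) (sym (lookup-restrL s π j))))
         , refines (λ i j e → trans (lookup-restrR s π i) (trans
              (merge p _ _ (Equivalence.from (union-sameʳ s σ τ i j) e)) (sym (lookup-restrR s π j)))))
    (λ { (p , q) → refines λ v w e → joined p q (union-together s σ τ e) })
    where
    joined : σ ⊑ restrL s π → τ ⊑ restrR s π → ∀ {v w} → Together s σ τ v w → lookup π v ≡ lookup π w
    joined p q (bothL {i} {j} e) = trans (sym (lookup-restrL s π i)) (trans (merge p i j e) (lookup-restrL s π j))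
    joined p q (bothR {i} {j} e) = trans (sym (lookup-restrR s π i)) (trans (merge q i j e) (lookup-restrR s π j))

  union-⊑-union : (s : Split n k l) {β σ : Lab k} {γ τ : Lab l} →
    union s β γ ⊑ union s σ τ ⇔ (β ⊑ σ × γ ⊑ τ)
  union-⊑-union s {β} {σ} {γ} {τ} = mk⇔
    (λ p → let (q , r) = Equivalence.to (union-⊑ s) p
           in ⊑-trans q (proj₁ (restrL-union s σ τ)) , ⊑-trans r (proj₁ (restrR-union s σ τ)))
    (λ { (q , r) → Equivalence.from (union-⊑ s)
           (⊑-trans q (proj₂ (restrL-union s σ τ)) , ⊑-trans r (proj₂ (restrR-union s σ τ))) })

  union-≅-union : (s : Split n k l) {β σ : Lab k} {γ τ : Lab l} →
    union s β γ ≅ union s σ τ ⇔ (β ≅ σ × γ ≅ τ)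
  union-≅-union s = mk⇔
    (λ { (p , q) → let (p₁ , p₂) = Equivalence.to (union-⊑-union s) p
                       (q₁ , q₂) = Equivalence.to (union-⊑-union s) q
                   in (p₁ , q₁) , (p₂ , q₂) })
    (λ { ((p₁ , q₁) , (p₂ , q₂)) →
         Equivalence.from (union-⊑-union s) (p₁ , p₂) , Equivalence.from (union-⊑-union s) (q₁ , q₂) })

  -- No block of a partition below σ ∪ τ meets both S and T.
  ⊑-union⇒≅-union-restr : (s : Split n k l) {σ : Lab k} {τ : Lab l} {α : Lab n} →
    α ⊑ union s σ τ → α ≅ union s (restrL s α) (restrR s α)
  ⊑-union⇒≅-union-restr s {σ} {τ} {α} p =
    refines (λ v w e → apart (union-together s σ τ (merge p v w e)) e) ,
    Equivalence.from (union-⊑ s) (⊑-refl _ , ⊑-refl _)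
    where
    apart : ∀ {v w} → Together s σ τ v w → lookup α v ≡ lookup α w →
            lookup (union s (restrL s α) (restrR s α)) v ≡ lookup (union s (restrL s α) (restrR s α)) w
    apart (bothL {i} {j} _) e = Equivalence.from (union-sameˡ s _ _ i j)
      (trans (lookup-restrL s α i) (trans e (sym (lookup-restrL s α j))))
    apart (bothR {i} {j} _) e = Equivalence.from (union-sameʳ s _ _ i j)
      (trans (lookup-restrR s α i) (trans e (sym (lookup-restrR s α j))))

  union-≅ : (s : Split n k l) {σ : Lab k} {τ : Lab l} {π : Lab n} →
    union s σ τ ≅ π ⇔ (π ≅ union s (restrL s π) (restrR s π) × σ ≅ restrL s π × τ ≅ restrR s π)
  union-≅ s {σ} {τ} {π} = mk⇔
    (λ e → ⊑-union⇒≅-union-restr s (proj₂ e)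
         , ≅-trans (≅-sym (restrL-union s σ τ)) (restrL-≅ s e)
         , ≅-trans (≅-sym (restrR-union s σ τ)) (restrR-≅ s e))
    (λ { (π≅ , σ≅ , τ≅) → ≅-trans (Equivalence.from (union-≅-union s) (σ≅ , τ≅)) (≅-sym π≅) })

  embL-flip : (s : Split n k l) (i : Fin l) → embL (flip s) i ≡ embR s i
  embL-flip (left s)  i       = cong suc (embL-flip s i)
  embL-flip (right s) zero    = refl
  embL-flip (right s) (suc i) = cong suc (embL-flip s i)

  embR-flip : (s : Split n k l) (i : Fin k) → embR (flip s) i ≡ embL s i
  embR-flip (left s)  zero    = refl
  embR-flip (left s)  (suc i) = cong suc (embR-flip s i)
  embR-flip (right s) i       = cong suc (embR-flip s i)

  restrL-flip : (s : Split n k l) (π : Lab n) → restrL (flip s) π ≡ restrR s π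
  restrL-flip s π = tabulate-cong λ i → cong (lookup π) (embL-flip s i)

  restrR-flip : (s : Split n k l) (π : Lab n) → restrR (flip s) π ≡ restrL s π
  restrR-flip s π = tabulate-cong λ i → cong (lookup π) (embR-flip s i)

  union-flip : (s : Split n k l) (σ : Lab k) (τ : Lab l) → union (flip s) τ σ ≅ union s σ τ
  union-flip s σ τ =
    Equivalence.from (union-⊑ (flip s))
      ( subst (τ ⊑_) (sym (restrL-flip s (union s σ τ))) (proj₂ (restrR-union s σ τ))
      , subst (σ ⊑_) (sym (restrR-flip s (union s σ τ))) (proj₂ (restrL-union s σ τ))) ,
    Equivalence.from (union-⊑ s)
      ( subst (σ ⊑_) (restrR-flip s (union (flip s) τ σ)) (proj₂ (restrR-union (flip s) τ σ))
      , subst (τ ⊑_) (restrL-flip s (union (flip s) τ σ)) (proj₂ (restrL-union (flip s) τ σ)))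

  stable? : (G : Graph n) (α : Lab n) → Dec (Stable G α)
  stable? G α = all? λ i → all? λ j → T? (adj G i j) →-dec ¬? (lookup α i ≟ lookup α j)

  stable-⊑ : (G : Graph n) {α σ : Lab n} → α ⊑ σ → Stable G σ → Stable G α
  stable-⊑ G p st i j a e = st i j a (merge p i j e)

  stable-union : (G : Graph n) (s : Split n k l) {σ : Lab k} {τ : Lab l} →
    Stable (GL s G) σ → Stable (GR s G) τ → Stable G (union s σ τ)
  stable-union G s {σ} {τ} p q v w a e with union-together s σ τ e
  ... | bothL e′ = p _ _ a e′
  ... | bothR e′ = q _ _ a e′

  stable-restrL : (G : Graph n) (s : Split n k l) {π : Lab n} → Stable G π → Stable (GL s G) (restrL s π)
  stable-restrL G s {π} p i j a e = p _ _ a (trans (sym (lookup-restrL s π i)) (trans e (lookup-restrL s π j)))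

  stable-restrR : (G : Graph n) (s : Split n k l) {π : Lab n} → Stable G π → Stable (GR s G) (restrR s π)
  stable-restrR G s {π} p i j a e = p _ _ a (trans (sym (lookup-restrR s π i)) (trans e (lookup-restrR s π j)))

  relabel-⊑ : (ρ : Permutation′ n) {α β : Lab n} → α ⊑ β → relabel ρ α ⊑ relabel ρ β
  relabel-⊑ ρ {α} {β} p = refines λ i j e → trans (lookup∘tabulate _ i) (trans
    (merge p _ _ (trans (sym (lookup∘tabulate _ i)) (trans e (lookup∘tabulate _ j)))) (sym (lookup∘tabulate _ j)))

  relabel-inverse : (ρ : Permutation′ n) (α : Lab n) → relabel (P.flip ρ) (relabel ρ α) ≡ α
  relabel-inverse ρ α = lookup-extensionality λ j →
    trans (lookup∘tabulate (λ j → lookup (relabel ρ α) (ρ P.⟨$⟩ʳ j)) j)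
      (trans (lookup∘tabulate (λ j → lookup α (ρ P.⟨$⟩ˡ j)) (ρ P.⟨$⟩ʳ j)) (cong (lookup α) (P.inverseˡ ρ)))

  relabel-⊑⇔ : (ρ : Permutation′ n) {α β : Lab n} → relabel ρ α ⊑ relabel ρ β ⇔ α ⊑ β
  relabel-⊑⇔ ρ {α} {β} = mk⇔
    (λ p → subst₂ _⊑_ (relabel-inverse ρ α) (relabel-inverse ρ β) (relabel-⊑ (P.flip ρ) p))
    (relabel-⊑ ρ)

  relabel-≅-flip : (ρ : Permutation′ n) {α β : Lab n} → β ≅ relabel (P.flip ρ) α ⇔ relabel ρ β ≅ α
  relabel-≅-flip ρ {α} {β} = mk⇔
    (λ { (p , q) → subst (relabel ρ β ⊑_) (relabel-inverse (P.flip ρ) α) (relabel-⊑ ρ p)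
                 , subst (_⊑ relabel ρ β) (relabel-inverse (P.flip ρ) α) (relabel-⊑ ρ q) })
    (λ { (p , q) → subst (_⊑ relabel (P.flip ρ) α) (relabel-inverse ρ β) (relabel-⊑ (P.flip ρ) p)
                 , subst (relabel (P.flip ρ) α ⊑_) (relabel-inverse ρ β) (relabel-⊑ (P.flip ρ) q) })

open Partitions

module Linear {c ℓ} (K : Field c ℓ) where

  open import Data.Nat as ℕ using (_<_; _≤_)
  import Data.Nat.Induction as ℕ
  import Data.Nat.Properties as ℕ
  open import Data.Vec.Properties using (∷-injective; ≡-dec)
  open import Level using (Level)
  open import Induction.WellFounded as WF using (WellFounded; module Subrelation)
  import Relation.Binary.Construct.On as On
  open P using (Permutation′)
  open import Relation.Binary.PropositionalEquality as ≡ using (_≡_)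
  open Field K hiding (zero)
  open import Relation.Binary.Reasoning.Setoid setoid
  open import Algebra.Properties.CommutativeSemigroup +-commutativeSemigroup using (interchange)
  open import Algebra.Properties.CommutativeSemigroup *-commutativeSemigroup
    using (x∙yz≈y∙xz; x∙yz≈z∙xy; xy∙z≈y∙xz) renaming (interchange to *-interchange)

  private variable
    a b p q : Level
    A : Set a
    B : Set b
    P : Set p
    Q : Set q

  ∑ : List A → (A → Carrier) → Carrier
  ∑ []       f = 0#
  ∑ (x ∷ xs) f = f x + ∑ xs f

  syntax ∑ xs (λ x → e) = ∑[ x ∈ xs ] e

  ∑-cong : (xs : List A) {f g : A → Carrier} → (∀ x → f x ≈ g x) → ∑ xs f ≈ ∑ xs g
  ∑-cong []       h = refl
  ∑-cong (x ∷ xs) h = +-cong (h x) (∑-cong xs h)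

  ∑-zero : (xs : List A) {f : A → Carrier} → (∀ x → f x ≈ 0#) → ∑ xs f ≈ 0#
  ∑-zero []       h = refl
  ∑-zero (x ∷ xs) h = trans (+-cong (h x) (∑-zero xs h)) (+-identityˡ 0#)

  ∑-distrib-+ : (xs : List A) (f g : A → Carrier) → ∑[ x ∈ xs ] (f x + g x) ≈ ∑ xs f + ∑ xs g
  ∑-distrib-+ []       f g = sym (+-identityˡ 0#)
  ∑-distrib-+ (x ∷ xs) f g = trans (+-congˡ (∑-distrib-+ xs f g)) (interchange _ _ _ _)

  *-∑ : (xs : List A) (k : Carrier) (f : A → Carrier) → k * ∑ xs f ≈ ∑[ x ∈ xs ] (k * f x)
  *-∑ []       k f = zeroʳ k
  *-∑ (x ∷ xs) k f = trans (distribˡ k (f x) (∑ xs f)) (+-congˡ (*-∑ xs k f))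

  ∑-comm : (xs : List A) (ys : List B) (g : A → B → Carrier) →
    ∑[ x ∈ xs ] ∑[ y ∈ ys ] g x y ≈ ∑[ y ∈ ys ] ∑[ x ∈ xs ] g x y
  ∑-comm []       ys g = sym (∑-zero ys λ _ → refl)
  ∑-comm (x ∷ xs) ys g = trans (+-congˡ (∑-comm xs ys g)) (sym (∑-distrib-+ ys (g x) _))

  ∑-map : (h : A → B) (xs : List A) (f : B → Carrier) → ∑ (map h xs) f ≡ ∑[ x ∈ xs ] f (h x)
  ∑-map h []       f = ≡.refl
  ∑-map h (x ∷ xs) f = ≡.cong (f (h x) +_) (∑-map h xs f)

  ∑-concatMap : (h : A → List B) (xs : List A) (f : B → Carrier) →
    ∑ (concatMap h xs) f ≈ ∑[ x ∈ xs ] ∑ (h x) f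
  ∑-concatMap h []       f = refl
  ∑-concatMap h (x ∷ xs) f = trans (∑-++ (h x)) (+-congˡ (∑-concatMap h xs f))
    where
    ∑-++ : ∀ ys {zs} → ∑ (ys ++ zs) f ≈ ∑ ys f + ∑ zs f
    ∑-++ []       = sym (+-identityˡ _)
    ∑-++ (y ∷ ys) = trans (+-congˡ (∑-++ ys)) (sym (+-assoc _ _ _))

  infix 4 _≟ᵥ_
  _≟ᵥ_ : (v w : Vec ℕ n) → Dec (v ≡ w)
  _≟ᵥ_ = ≡-dec ℕ._≟_

  -- Opaque, so that unification can recover the decision p from 𝟙 p.
  opaque
    𝟙 : Dec P → Carrier
    𝟙 (yes _) = 1#
    𝟙 (no  _) = 0#

  opaque
    unfolding 𝟙

    𝟙-⇔ : (p : Dec P) (q : Dec Q) → P ⇔ Q → 𝟙 p ≈ 𝟙 q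
    𝟙-⇔ (yes _) (yes _) _ = refl
    𝟙-⇔ (no  _) (no  _) _ = refl
    𝟙-⇔ (yes p) (no ¬q) e = contradiction (Equivalence.to e p) ¬q
    𝟙-⇔ (no ¬p) (yes q) e = contradiction (Equivalence.from e q) ¬p

    𝟙-× : (p : Dec P) (q : Dec Q) → 𝟙 (p ×-dec q) ≈ 𝟙 p * 𝟙 q
    𝟙-× (yes _) (yes _) = sym (*-identityˡ _)
    𝟙-× (yes _) (no  _) = sym (*-identityˡ _)
    𝟙-× (no  _) _       = sym (zeroˡ _)

    𝟙-yes : (p : Dec P) → P → 𝟙 p ≈ 1#
    𝟙-yes (yes _) _ = refl
    𝟙-yes (no ¬p) p = contradiction p ¬p

    𝟙-no : (p : Dec P) → ¬ P → 𝟙 p ≈ 0#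
    𝟙-no (yes p) ¬p = contradiction p ¬p
    𝟙-no (no  _) _  = refl

    𝟙-*-cong : (p : Dec P) {x y : Carrier} → (P → x ≈ y) → 𝟙 p * x ≈ 𝟙 p * y
    𝟙-*-cong (yes p) h = *-congˡ (h p)
    𝟙-*-cong (no  _) h = trans (zeroˡ _) (sym (zeroˡ _))

    𝟙-*-zero : (p : Dec P) {x : Carrier} → (P → x ≈ 0#) → 𝟙 p * x ≈ 0#
    𝟙-*-zero p h = trans (𝟙-*-cong p h) (zeroʳ _)

    𝟙-split : (p : Dec P) (q : Dec Q) → 𝟙 p ≈ 𝟙 (p ×-dec q) + 𝟙 (p ×-dec ¬? q)
    𝟙-split (yes _) (yes _) = sym (+-identityʳ _)
    𝟙-split (yes _) (no  _) = sym (+-identityˡ _)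
    𝟙-split (no  _) _       = sym (+-identityˡ _)

    if-≈-𝟙 : (b : Bool) (p : Dec P) → T b ⇔ P → (x r : Carrier) → (if b then x + r else r) ≈ x * 𝟙 p + r
    if-≈-𝟙 true  (yes _) _ x r = +-congʳ (sym (*-identityʳ x))
    if-≈-𝟙 false (no  _) _ x r = sym (trans (+-congʳ (zeroʳ x)) (+-identityˡ r))
    if-≈-𝟙 true  (no ¬p) e x r = contradiction (Equivalence.to e tt) ¬p
    if-≈-𝟙 false (yes p) e x r = contradiction (Equivalence.from e p) λ ()

    *-𝟙-absorb : (p : Dec P) {c x : Carrier} → (P → c ≈ 1#) → c * (𝟙 p * x) ≈ 𝟙 p * x
    *-𝟙-absorb (yes p) h = trans (*-congʳ (h p)) (*-identityˡ _)
    *-𝟙-absorb (no  _) h = trans (*-congˡ (zeroˡ _)) (trans (zeroʳ _) (sym (zeroˡ _)))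

  ∑-downFrom-absent : ∀ m b (g : ℕ → Carrier) → m ≤ b → ∑[ a ∈ downFrom m ] (𝟙 (a ℕ.≟ b) * g a) ≈ 0#
  ∑-downFrom-absent zero    b g _     = refl
  ∑-downFrom-absent (suc m) b g 1+m≤b =
    trans (+-cong (𝟙-*-zero (m ℕ.≟ b) λ m≡b → contradiction m≡b (ℕ.<⇒≢ 1+m≤b))
                  (∑-downFrom-absent m b g (ℕ.<⇒≤ 1+m≤b)))
          (+-identityˡ 0#)

  ∑-downFrom-δ : ∀ m b (g : ℕ → Carrier) → b < m → ∑[ a ∈ downFrom m ] (𝟙 (a ℕ.≟ b) * g a) ≈ g b
  ∑-downFrom-δ (suc m) b g b<1+m with m ℕ.≟ b
  ... | yes ≡.refl = trans (+-cong (trans (*-congʳ (𝟙-yes _ ≡.refl)) (*-identityˡ _))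
                                   (∑-downFrom-absent m m g ℕ.≤-refl))
                           (+-identityʳ _)
  ... | no m≢b     = trans (+-cong (𝟙-*-zero _ λ m≡b → contradiction m≡b m≢b)
                                   (∑-downFrom-δ m b g (ℕ.≤∧≢⇒< (ℕ.≤-pred b<1+m) (m≢b ∘ ≡.sym))))
                           (+-identityˡ _)

  ∑-vectors-δ : ∀ m n (w : Vec ℕ n) (h : Vec ℕ n → Carrier) → (∀ i → lookup w i < m) →
    ∑[ v ∈ vectors m n ] (𝟙 (v ≟ᵥ w) * h v) ≈ h w
  ∑-vectors-δ m zero    []      h _  =
    trans (+-identityʳ _) (trans (*-congʳ (𝟙-yes ([] ≟ᵥ []) ≡.refl)) (*-identityˡ _))
  ∑-vectors-δ m (suc n) (b ∷ w) h bd = begin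
    ∑ (concatMap (λ a → map (a ∷_) (vectors m n)) (downFrom m)) F
      ≈⟨ ∑-concatMap _ (downFrom m) F ⟩
    ∑[ a ∈ downFrom m ] ∑ (map (a ∷_) (vectors m n)) F
      ≈⟨ ∑-cong (downFrom m) (λ a → reflexive (∑-map (a ∷_) (vectors m n) F)) ⟩
    ∑[ a ∈ downFrom m ] ∑[ v ∈ vectors m n ] F (a ∷ v)
      ≈⟨ ∑-cong (downFrom m) (λ a → ∑-cong (vectors m n) (λ v → split a v)) ⟩
    ∑[ a ∈ downFrom m ] ∑[ v ∈ vectors m n ] (𝟙 (a ℕ.≟ b) * (𝟙 (v ≟ᵥ w) * h (a ∷ v)))
      ≈⟨ ∑-cong (downFrom m) (λ a → sym (*-∑ (vectors m n) _ _)) ⟩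
    ∑[ a ∈ downFrom m ] (𝟙 (a ℕ.≟ b) * ∑[ v ∈ vectors m n ] (𝟙 (v ≟ᵥ w) * h (a ∷ v)))
      ≈⟨ ∑-cong (downFrom m) (λ a → *-congˡ (∑-vectors-δ m n w (h ∘ (a ∷_)) (bd ∘ suc))) ⟩
    ∑[ a ∈ downFrom m ] (𝟙 (a ℕ.≟ b) * h (a ∷ w))
      ≈⟨ ∑-downFrom-δ m b (λ a → h (a ∷ w)) (bd zero) ⟩
    h (b ∷ w) ∎
    where
    F : Vec ℕ (suc n) → Carrier
    F v = 𝟙 (v ≟ᵥ b ∷ w) * h v
    split : ∀ a v → F (a ∷ v) ≈ 𝟙 (a ℕ.≟ b) * (𝟙 (v ≟ᵥ w) * h (a ∷ v))
    split a v = trans (*-congʳ (trans (𝟙-⇔ (a ∷ v ≟ᵥ b ∷ w) ((a ℕ.≟ b) ×-dec (v ≟ᵥ w))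
                                             (mk⇔ ∷-injective λ { (≡.refl , ≡.refl) → ≡.refl }))
                                      (𝟙-× (a ℕ.≟ b) (v ≟ᵥ w))))
                      (*-assoc _ _ _)

  -- A sum over the set partitions of Fin n: each labelling is ≅ to exactly one canonical one,
  -- and canonical labellings take values below n.
  opaque
    ∑ₚ : (n : ℕ) → (Lab n → Carrier) → Carrier
    ∑ₚ n f = ∑[ v ∈ vectors n n ] (𝟙 (canonical? v) * f v)

  syntax ∑ₚ n (λ α → e) = ∑[ α ⊢ n ] e

  Invariant : (Lab n → Carrier) → Set ℓ
  Invariant F = ∀ {α β} → α ≅ β → F α ≈ F β

  ⊑-invariantˡ : (π : Lab n) → Invariant (λ α → 𝟙 (α ⊑? π))
  ⊑-invariantˡ π {α} {α′} e = 𝟙-⇔ (α ⊑? π) (α′ ⊑? π) (mk⇔ (⊑-trans (proj₂ e)) (⊑-trans (proj₁ e)))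

  ⊑-invariantʳ : (α : Lab n) → Invariant (λ π → 𝟙 (α ⊑? π))
  ⊑-invariantʳ α {π} {π′} e =
    𝟙-⇔ (α ⊑? π) (α ⊑? π′) (mk⇔ (λ p → ⊑-trans p (proj₁ e)) (λ p → ⊑-trans p (proj₂ e)))

  ≅-invariantˡ : (π : Lab n) → Invariant (λ α → 𝟙 (α ≅? π))
  ≅-invariantˡ π {α} {α′} e = 𝟙-⇔ (α ≅? π) (α′ ≅? π) (mk⇔ (≅-trans (≅-sym e)) (≅-trans e))

  ≅-invariantʳ : (α : Lab n) → Invariant (λ π → 𝟙 (α ≅? π))
  ≅-invariantʳ α {π} {π′} e = 𝟙-⇔ (α ≅? π) (α ≅? π′) (mk⇔ (λ p → ≅-trans p e) (λ p → ≅-trans p (≅-sym e)))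

  opaque
    unfolding ∑ₚ

    ∑ₚ-cong-canonical : {f g : Lab n → Carrier} → (∀ α → IsCanonical α → f α ≈ g α) → ∑ₚ n f ≈ ∑ₚ n g
    ∑ₚ-cong-canonical {n} h = ∑-cong (vectors n n) λ v → 𝟙-*-cong (canonical? v) (h v)

    ∑ₚ-cong : {f g : Lab n → Carrier} → (∀ α → f α ≈ g α) → ∑ₚ n f ≈ ∑ₚ n g
    ∑ₚ-cong h = ∑ₚ-cong-canonical λ α _ → h α

    ∑ₚ-zero : {f : Lab n → Carrier} → (∀ α → f α ≈ 0#) → ∑ₚ n f ≈ 0#
    ∑ₚ-zero {n} h = ∑-zero (vectors n n) λ v → trans (*-congˡ (h v)) (zeroʳ _)

    ∑ₚ-distrib-+ : (f g : Lab n → Carrier) → ∑[ α ⊢ n ] (f α + g α) ≈ ∑ₚ n f + ∑ₚ n g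
    ∑ₚ-distrib-+ {n} f g =
      trans (∑-cong (vectors n n) λ v → distribˡ _ (f v) (g v)) (∑-distrib-+ (vectors n n) _ _)

    *-∑ₚ : (k : Carrier) (f : Lab n → Carrier) → k * ∑ₚ n f ≈ ∑[ α ⊢ n ] (k * f α)
    *-∑ₚ {n} k f = trans (*-∑ (vectors n n) k _) (∑-cong (vectors n n) λ v → x∙yz≈y∙xz k _ (f v))

    ∑ₚ-* : (k : Carrier) (f : Lab n → Carrier) → ∑ₚ n f * k ≈ ∑[ α ⊢ n ] (f α * k)
    ∑ₚ-* {n} k f = trans (*-comm _ k) (trans (*-∑ₚ k f) (∑ₚ-cong λ α → *-comm k (f α)))

    ∑-∑ₚ-comm : (xs : List A) (g : A → Lab n → Carrier) →
      ∑[ x ∈ xs ] ∑ₚ n (g x) ≈ ∑[ α ⊢ n ] ∑[ x ∈ xs ] g x α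
    ∑-∑ₚ-comm {n = n} xs g = trans (∑-comm xs (vectors n n) _)
      (∑-cong (vectors n n) λ v → sym (*-∑ xs (𝟙 (canonical? v)) (λ x → g x v)))

    ∑ₚ-comm : (g : Lab n → Lab k → Carrier) →
      ∑[ α ⊢ n ] ∑ₚ k (g α) ≈ ∑[ β ⊢ k ] ∑[ α ⊢ n ] g α β
    ∑ₚ-comm {n} {k} g = trans (∑-cong (vectors n n) λ α → *-∑ₚ (𝟙 (canonical? α)) (g α))
      (∑-∑ₚ-comm (vectors n n) λ α β → 𝟙 (canonical? α) * g α β)

    ∑ₚ-δ : (u : Lab n) (h : Lab n → Carrier) → ∑[ α ⊢ n ] (𝟙 (α ≅? u) * h α) ≈ h (canon u)
    ∑ₚ-δ {n} u h = begin
      ∑[ v ∈ vectors n n ] (𝟙 (canonical? v) * (𝟙 (v ≅? u) * h v))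
        ≈⟨ ∑-cong (vectors n n) (λ v → trans (sym (*-assoc _ _ _)) (*-congʳ (equation v))) ⟩
      ∑[ v ∈ vectors n n ] (𝟙 (v ≟ᵥ canon u) * h v)
        ≈⟨ ∑-vectors-δ n n (canon u) h (canon-< u) ⟩
      h (canon u) ∎
      where
      equation : ∀ v → 𝟙 (canonical? v) * 𝟙 (v ≅? u) ≈ 𝟙 (v ≟ᵥ canon u)
      equation v = trans (sym (𝟙-× (canonical? v) (v ≅? u)))
                         (𝟙-⇔ (canonical? v ×-dec (v ≅? u)) (v ≟ᵥ canon u) canonical-≅⇔≡canon)

  ∑ₚ-δ-invariant : (u : Lab n) (F : Lab n → Carrier) → Invariant F → ∑[ α ⊢ n ] (𝟙 (α ≅? u) * F α) ≈ F u
  ∑ₚ-δ-invariant u F inv = trans (∑ₚ-δ u F) (inv (≅-sym (canon-≅ u)))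

  ∑ₚ-δ-canonical : (u : Lab n) (h : Lab n → Carrier) → IsCanonical u → ∑[ α ⊢ n ] (𝟙 (α ≅? u) * h α) ≈ h u
  ∑ₚ-δ-canonical u h c = trans (∑ₚ-δ u h) (reflexive (≡.cong h c))

  ∑ₚ-δ-one : (u : Lab n) → ∑[ α ⊢ n ] 𝟙 (α ≅? u) ≈ 1#
  ∑ₚ-δ-one {n} u = trans (∑ₚ-cong {n} λ α → sym (*-identityʳ _)) (∑ₚ-δ-invariant u (λ _ → 1#) (λ _ → refl))

  ∑ₚ-product : (f : Lab k → Carrier) (g : Lab l → Carrier) →
    ∑[ β ⊢ k ] ∑[ γ ⊢ l ] (f β * g γ) ≈ ∑ₚ k f * ∑ₚ l g
  ∑ₚ-product {k} {l} f g =
    trans (∑ₚ-cong {k} λ β → sym (*-∑ₚ (f β) g)) (sym (∑ₚ-* (∑ₚ l g) f))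

  -- SΠ is a Hopf submonoid

  linear : (Lab n → Carrier) → FSum K n → Carrier
  linear F x = ∑[ p ∈ x ] (proj₁ p * F (proj₂ p))

  linear₂ : (Lab k → Lab l → Carrier) → TSum K k l → Carrier
  linear₂ G w = ∑[ p ∈ w ] (proj₁ p * G (proj₁ (proj₂ p)) (proj₂ (proj₂ p)))

  linear-cong : (x : FSum K n) {F G : Lab n → Carrier} → (∀ α → F α ≈ G α) → linear F x ≈ linear G x
  linear-cong x h = ∑-cong x λ p → *-congˡ (h (proj₂ p))

  linear₂-cong : (w : TSum K k l) {F G : Lab k → Lab l → Carrier} →
    (∀ σ τ → F σ τ ≈ G σ τ) → linear₂ F w ≈ linear₂ G w
  linear₂-cong w h = ∑-cong w λ p → *-congˡ (h (proj₁ (proj₂ p)) (proj₂ (proj₂ p)))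

  linear₂-* : (w : TSum K k l) (z : Carrier) (G : Lab k → Lab l → Carrier) →
    linear₂ (λ σ τ → z * G σ τ) w ≈ z * linear₂ G w
  linear₂-* w z G = trans (∑-cong w λ p → x∙yz≈y∙xz (proj₁ p) z _) (sym (*-∑ w z _))

  coeff-linear : (π : Lab n) (x : FSum K n) → coeff K π x ≈ linear (λ α → 𝟙 (α ≅? π)) x
  coeff-linear π []            = refl
  coeff-linear π ((a , α) ∷ x) =
    trans (if-≈-𝟙 (α ~ᵇ π) (α ≅? π) T-~ᵇ a _) (+-congˡ (coeff-linear π x))

  coeffT-linear : (σ : Lab k) (τ : Lab l) (w : TSum K k l) →
    coeffT K σ τ w ≈ linear₂ (λ α β → 𝟙 (α ≅? σ) * 𝟙 (β ≅? τ)) w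
  coeffT-linear σ τ []                = refl
  coeffT-linear σ τ ((a , α , β) ∷ w) =
    trans (if-≈-𝟙 ((α ~ᵇ σ) ∧ (β ~ᵇ τ)) ((α ≅? σ) ×-dec (β ≅? τ))
                  (mk⇔ (λ t → let (t₁ , t₂) = Equivalence.to T-∧ t
                              in Equivalence.to T-~ᵇ t₁ , Equivalence.to T-~ᵇ t₂)
                       (λ { (e₁ , e₂) → Equivalence.from T-∧ (Equivalence.from T-~ᵇ e₁ , Equivalence.from T-~ᵇ e₂) }))
                  a _)
          (+-cong (*-congˡ (𝟙-× (α ≅? σ) (β ≅? τ))) (coeffT-linear σ τ w))

  coeff-invariant : (x : FSum K n) → Invariant (λ ρ → coeff K ρ x)
  coeff-invariant x {ρ} {ρ′} e =
    trans (coeff-linear ρ x) (trans (linear-cong x λ α → ≅-invariantʳ α e) (sym (coeff-linear ρ′ x)))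

  linear-coeff : (x : FSum K n) (F : Lab n → Carrier) → Invariant F →
    linear F x ≈ ∑[ ρ ⊢ n ] (F ρ * coeff K ρ x)
  linear-coeff {n} x F inv = begin
    ∑[ p ∈ x ] (proj₁ p * F (proj₂ p))
      ≈⟨ ∑-cong x (λ p → *-congˡ (sym (∑ₚ-δ-invariant (proj₂ p) F inv))) ⟩
    ∑[ p ∈ x ] (proj₁ p * ∑[ ρ ⊢ n ] (𝟙 (ρ ≅? proj₂ p) * F ρ))
      ≈⟨ ∑-cong x (λ p → *-∑ₚ (proj₁ p) _) ⟩
    ∑[ p ∈ x ] ∑[ ρ ⊢ n ] (proj₁ p * (𝟙 (ρ ≅? proj₂ p) * F ρ))
      ≈⟨ ∑-∑ₚ-comm x _ ⟩
    ∑[ ρ ⊢ n ] ∑[ p ∈ x ] (proj₁ p * (𝟙 (ρ ≅? proj₂ p) * F ρ))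
      ≈⟨ ∑ₚ-cong (λ ρ → ∑-cong x λ p → rearrange (proj₁ p) (F ρ) ρ (proj₂ p)) ⟩
    ∑[ ρ ⊢ n ] ∑[ p ∈ x ] (F ρ * (proj₁ p * 𝟙 (proj₂ p ≅? ρ)))
      ≈⟨ ∑ₚ-cong (λ ρ → trans (sym (*-∑ x (F ρ) _)) (*-congˡ (sym (coeff-linear ρ x)))) ⟩
    ∑[ ρ ⊢ n ] (F ρ * coeff K ρ x) ∎
    where
    rearrange : ∀ a z ρ α → a * (𝟙 (ρ ≅? α) * z) ≈ z * (a * 𝟙 (α ≅? ρ))
    rearrange a z ρ α = trans (x∙yz≈z∙xy a _ z) (*-congˡ (*-congˡ (𝟙-⇔ (ρ ≅? α) (α ≅? ρ) (mk⇔ ≅-sym ≅-sym))))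

  coeff-μ : (s : Split n k l) (w : TSum K k l) (π : Lab n) →
    coeff K π (μ K s w) ≈ linear₂ (λ σ τ → 𝟙 (union s σ τ ≅? π)) w
  coeff-μ s w π = trans (coeff-linear π (μ K s w)) (reflexive (∑-map _ w _))

  coeff-μ-restr : (s : Split n k l) (w : TSum K k l) (π : Lab n) →
    coeff K π (μ K s w) ≈ 𝟙 (π ≅? union s (restrL s π) (restrR s π)) * coeffT K (restrL s π) (restrR s π) w
  coeff-μ-restr s w π = begin
    coeff K π (μ K s w)
      ≈⟨ coeff-μ s w π ⟩
    linear₂ (λ σ τ → 𝟙 (union s σ τ ≅? π)) w
      ≈⟨ linear₂-cong w (λ σ τ → trans
           (𝟙-⇔ (union s σ τ ≅? π) ((π ≅? union s πS πT) ×-dec (σ ≅? πS) ×-dec (τ ≅? πT)) (union-≅ s))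
           (trans (𝟙-× (π ≅? union s πS πT) _) (*-congˡ (𝟙-× (σ ≅? πS) (τ ≅? πT))))) ⟩
    linear₂ (λ σ τ → 𝟙 (π ≅? union s πS πT) * (𝟙 (σ ≅? πS) * 𝟙 (τ ≅? πT))) w
      ≈⟨ linear₂-* w _ _ ⟩
    𝟙 (π ≅? union s πS πT) * linear₂ (λ σ τ → 𝟙 (σ ≅? πS) * 𝟙 (τ ≅? πT)) w
      ≈⟨ *-congˡ (sym (coeffT-linear πS πT w)) ⟩
    𝟙 (π ≅? union s πS πT) * coeffT K πS πT w ∎
    where
    πS = restrL s π
    πT = restrR s π

  coeffT-Δ : (s : Split n k l) (z : FSum K n) (σ : Lab k) (τ : Lab l) →
    coeffT K σ τ (Δ K s z) ≈ ∑[ ρ ⊢ n ] (𝟙 (restrL s ρ ≅? σ) * 𝟙 (restrR s ρ ≅? τ) * coeff K ρ z)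
  coeffT-Δ s z σ τ =
    trans (coeffT-linear σ τ (Δ K s z)) (trans (reflexive (∑-map _ z _)) (linear-coeff z _ invariant))
    where
    invariant : Invariant (λ ρ → 𝟙 (restrL s ρ ≅? σ) * 𝟙 (restrR s ρ ≅? τ))
    invariant e = *-cong (≅-invariantˡ σ (restrL-≅ s e)) (≅-invariantˡ τ (restrR-≅ s e))

  isHopfSubmonoid : IsHopfSubmonoid K
  isHopfSubmonoid = unit , product , coproduct
    where
    unit : ∀ (G : Graph 0) → InSΠ K G (η K 1#)
    unit G = η K 1# , (λ ()) ∷ [] , λ π → refl
    product : ∀ {n k l} (G : Graph n) (s : Split n k l) (w : TSum K k l) →
      InSΠ⊗SΠ K (GL s G) (GR s G) w → InSΠ K G (μ K s w)
    product G s w (u , u-stable , w≋u) =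
      μ K s u ,
      All.map⁺ (All.map (λ {p} st → stable-union G s {proj₁ (proj₂ p)} {proj₂ (proj₂ p)} (proj₁ st) (proj₂ st))
                        u-stable) ,
      λ π → trans (coeff-μ-restr s w π)
                  (trans (*-congˡ (w≋u (restrL s π) (restrR s π))) (sym (coeff-μ-restr s u π)))
    coproduct : ∀ {n k l} (G : Graph n) (s : Split n k l) (z : FSum K n) →
      InSΠ K G z → InSΠ⊗SΠ K (GL s G) (GR s G) (Δ K s z)
    coproduct G s z (y , y-stable , z≋y) =
      Δ K s y ,
      All.map⁺ (All.map (λ {p} st → stable-restrL G s {proj₂ p} st , stable-restrR G s {proj₂ p} st) y-stable) ,
      λ σ τ → trans (coeffT-Δ s z σ τ) (trans (∑ₚ-cong λ ρ → *-congˡ (z≋y ρ)) (sym (coeffT-Δ s y σ τ)))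

  isCommutative : IsCommutative K
  isCommutative G s w _ π = begin
    coeff K π (μ K (flip s) (swapT K w))
      ≈⟨ coeff-μ (flip s) (swapT K w) π ⟩
    linear₂ (λ τ σ → 𝟙 (union (flip s) τ σ ≅? π)) (swapT K w)
      ≡⟨ ∑-map _ w _ ⟩
    linear₂ (λ σ τ → 𝟙 (union (flip s) τ σ ≅? π)) w
      ≈⟨ linear₂-cong w (λ σ τ → ≅-invariantˡ π (union-flip s σ τ)) ⟩
    linear₂ (λ σ τ → 𝟙 (union s σ τ ≅? π)) w
      ≈⟨ coeff-μ s w π ⟨
    coeff K π (μ K s w) ∎

  swapT-Δ : (s : Split n k l) (z : FSum K n) → swapT K (Δ K s z) ≡ Δ K (flip s) z
  swapT-Δ s []            = ≡.refl
  swapT-Δ s ((a , π) ∷ z) =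
    ≡.cong₂ _∷_ (≡.cong₂ (λ σ τ → a , σ , τ) (≡.sym (restrL-flip s π)) (≡.sym (restrR-flip s π))) (swapT-Δ s z)

  isCocommutative : IsCocommutative K
  isCocommutative G s z _ σ τ = reflexive (≡.cong (coeffT K σ τ) (swapT-Δ s z))

  -- Self-duality

  union-decompositions : (s : Split n k l) {σ : Lab k} {τ : Lab l} {α : Lab n} → α ⊑ union s σ τ →
    ∑[ β ⊢ k ] ∑[ γ ⊢ l ] 𝟙 (α ≅? union s β γ) ≈ 1#
  union-decompositions {n} {k} {l} s {α = α} α⊑ = begin
    ∑[ β ⊢ k ] ∑[ γ ⊢ l ] 𝟙 (α ≅? union s β γ)
      ≈⟨ ∑ₚ-cong {k} (λ β → ∑ₚ-cong {l} λ γ → trans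
           (𝟙-⇔ (α ≅? union s β γ) ((β ≅? αS) ×-dec (γ ≅? αT))
             (mk⇔ (λ e → Equivalence.to (union-≅-union s) (≅-trans (≅-sym e) α≅))
                  (λ e → ≅-trans α≅ (≅-sym (Equivalence.from (union-≅-union s) e)))))
           (𝟙-× (β ≅? αS) (γ ≅? αT))) ⟩
    ∑[ β ⊢ k ] ∑[ γ ⊢ l ] (𝟙 (β ≅? αS) * 𝟙 (γ ≅? αT))
      ≈⟨ ∑ₚ-product (λ β → 𝟙 (β ≅? αS)) (λ γ → 𝟙 (γ ≅? αT)) ⟩
    ∑[ β ⊢ k ] 𝟙 (β ≅? αS) * ∑[ γ ⊢ l ] 𝟙 (γ ≅? αT)
      ≈⟨ *-cong (∑ₚ-δ-one αS) (∑ₚ-δ-one αT) ⟩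
    1# * 1#
      ≈⟨ *-identityˡ 1# ⟩
    1# ∎
    where
    αS = restrL s α
    αT = restrR s α
    α≅ : α ≅ union s αS αT
    α≅ = ⊑-union⇒≅-union-restr s α⊑

  ∑ₚ-⊑-union : (s : Split n k l) (σ : Lab k) (τ : Lab l) (H : Lab n → Carrier) → Invariant H →
    ∑[ α ⊢ n ] (𝟙 (α ⊑? union s σ τ) * H α) ≈
    ∑[ β ⊢ k ] ∑[ γ ⊢ l ] (𝟙 (β ⊑? σ) * 𝟙 (γ ⊑? τ) * H (union s β γ))
  ∑ₚ-⊑-union {n} {k} {l} s σ τ H inv = begin
    ∑[ α ⊢ n ] F α
      ≈⟨ ∑ₚ-cong {n} (λ α → sym (*-𝟙-absorb (α ⊑? union s σ τ) (union-decompositions s))) ⟩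
    ∑[ α ⊢ n ] ((∑[ β ⊢ k ] ∑[ γ ⊢ l ] 𝟙 (α ≅? union s β γ)) * F α)
      ≈⟨ ∑ₚ-cong {n} (λ α → trans (∑ₚ-* (F α) _) (∑ₚ-cong {k} λ β → ∑ₚ-* (F α) _)) ⟩
    ∑[ α ⊢ n ] ∑[ β ⊢ k ] ∑[ γ ⊢ l ] (𝟙 (α ≅? union s β γ) * F α)
      ≈⟨ ∑ₚ-comm _ ⟩
    ∑[ β ⊢ k ] ∑[ α ⊢ n ] ∑[ γ ⊢ l ] (𝟙 (α ≅? union s β γ) * F α)
      ≈⟨ ∑ₚ-cong {k} (λ β → ∑ₚ-comm _) ⟩
    ∑[ β ⊢ k ] ∑[ γ ⊢ l ] ∑[ α ⊢ n ] (𝟙 (α ≅? union s β γ) * F α)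
      ≈⟨ ∑ₚ-cong {k} (λ β → ∑ₚ-cong {l} λ γ → ∑ₚ-δ-invariant (union s β γ) F F-invariant) ⟩
    ∑[ β ⊢ k ] ∑[ γ ⊢ l ] F (union s β γ)
      ≈⟨ ∑ₚ-cong {k} (λ β → ∑ₚ-cong {l} λ γ → *-congʳ (trans
           (𝟙-⇔ (union s β γ ⊑? union s σ τ) ((β ⊑? σ) ×-dec (γ ⊑? τ)) (union-⊑-union s))
           (𝟙-× (β ⊑? σ) (γ ⊑? τ)))) ⟩
    ∑[ β ⊢ k ] ∑[ γ ⊢ l ] (𝟙 (β ⊑? σ) * 𝟙 (γ ⊑? τ) * H (union s β γ)) ∎
    where
    F : Lab n → Carrier
    F α = 𝟙 (α ⊑? union s σ τ) * H α
    F-invariant : Invariant F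
    F-invariant e = *-cong (⊑-invariantˡ (union s σ τ) e) (inv e)

  ∑ₚ-relabel : (ρ : Permutation′ n) (F : Lab n → Carrier) → Invariant F →
    ∑ₚ n F ≈ ∑[ β ⊢ n ] F (relabel ρ β)
  ∑ₚ-relabel {n} ρ F inv = begin
    ∑[ α ⊢ n ] F α
      ≈⟨ ∑ₚ-cong {n} (λ α → sym (trans (*-congʳ (∑ₚ-δ-one (relabel (P.flip ρ) α))) (*-identityˡ _))) ⟩
    ∑[ α ⊢ n ] ((∑[ β ⊢ n ] 𝟙 (β ≅? relabel (P.flip ρ) α)) * F α)
      ≈⟨ ∑ₚ-cong {n} (λ α → ∑ₚ-* (F α) _) ⟩
    ∑[ α ⊢ n ] ∑[ β ⊢ n ] (𝟙 (β ≅? relabel (P.flip ρ) α) * F α)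
      ≈⟨ ∑ₚ-comm _ ⟩
    ∑[ β ⊢ n ] ∑[ α ⊢ n ] (𝟙 (β ≅? relabel (P.flip ρ) α) * F α)
      ≈⟨ ∑ₚ-cong {n} (λ β → ∑ₚ-cong {n} λ α → *-congʳ
           (𝟙-⇔ (β ≅? relabel (P.flip ρ) α) (α ≅? relabel ρ β)
             (mk⇔ (≅-sym ∘ Equivalence.to (relabel-≅-flip ρ)) (Equivalence.from (relabel-≅-flip ρ) ∘ ≅-sym)))) ⟩
    ∑[ β ⊢ n ] ∑[ α ⊢ n ] (𝟙 (α ≅? relabel ρ β) * F α)
      ≈⟨ ∑ₚ-cong {n} (λ β → ∑ₚ-δ-invariant (relabel ρ β) F inv) ⟩
    ∑[ β ⊢ n ] F (relabel ρ β) ∎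

  commonRefinements : Lab n → Lab n → Carrier
  commonRefinements {n} σ π = ∑[ α ⊢ n ] (𝟙 (α ⊑? σ) * 𝟙 (α ⊑? π))

  commonRefinements-sym : (σ π : Lab n) → commonRefinements σ π ≈ commonRefinements π σ
  commonRefinements-sym {n} σ π = ∑ₚ-cong {n} λ α → *-comm _ _

  commonRefinements-cong : {σ σ′ π π′ : Lab n} → σ ≅ σ′ → π ≅ π′ →
    commonRefinements σ π ≈ commonRefinements σ′ π′
  commonRefinements-cong {n} e e′ = ∑ₚ-cong {n} λ α → *-cong (⊑-invariantʳ α e) (⊑-invariantʳ α e′)

  commonRefinements-union : (s : Split n k l) (σ : Lab k) (τ : Lab l) (π : Lab n) →
    commonRefinements (union s σ τ) π ≈
    commonRefinements σ (restrL s π) * commonRefinements τ (restrR s π)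
  commonRefinements-union {n} {k} {l} s σ τ π = begin
    ∑[ α ⊢ n ] (𝟙 (α ⊑? union s σ τ) * 𝟙 (α ⊑? π))
      ≈⟨ ∑ₚ-⊑-union s σ τ (λ α → 𝟙 (α ⊑? π)) (⊑-invariantˡ π) ⟩
    ∑[ β ⊢ k ] ∑[ γ ⊢ l ] (𝟙 (β ⊑? σ) * 𝟙 (γ ⊑? τ) * 𝟙 (union s β γ ⊑? π))
      ≈⟨ ∑ₚ-cong {k} (λ β → ∑ₚ-cong {l} λ γ → trans (*-congˡ (trans
           (𝟙-⇔ (union s β γ ⊑? π) ((β ⊑? πS) ×-dec (γ ⊑? πT)) (union-⊑ s)) (𝟙-× (β ⊑? πS) (γ ⊑? πT))))
           (*-interchange _ _ _ _)) ⟩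
    ∑[ β ⊢ k ] ∑[ γ ⊢ l ] (𝟙 (β ⊑? σ) * 𝟙 (β ⊑? πS) * (𝟙 (γ ⊑? τ) * 𝟙 (γ ⊑? πT)))
      ≈⟨ ∑ₚ-product _ _ ⟩
    commonRefinements σ πS * commonRefinements τ πT ∎
    where
    πS = restrL s π
    πT = restrR s π

  commonRefinements-relabel : (ρ : Permutation′ n) (σ π : Lab n) →
    commonRefinements (relabel ρ σ) (relabel ρ π) ≈ commonRefinements σ π
  commonRefinements-relabel {n} ρ σ π = begin
    ∑[ α ⊢ n ] F α                   ≈⟨ ∑ₚ-relabel ρ F F-invariant ⟩
    ∑[ β ⊢ n ] F (relabel ρ β)        ≈⟨ ∑ₚ-cong {n} (λ β → *-cong (𝟙-⇔ _ (β ⊑? σ) (relabel-⊑⇔ ρ))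
                                                                   (𝟙-⇔ _ (β ⊑? π) (relabel-⊑⇔ ρ))) ⟩
    commonRefinements σ π ∎
    where
    F : Lab n → Carrier
    F α = 𝟙 (α ⊑? relabel ρ σ) * 𝟙 (α ⊑? relabel ρ π)
    F-invariant : Invariant F
    F-invariant e = *-cong (⊑-invariantˡ (relabel ρ σ) e) (⊑-invariantˡ (relabel ρ π) e)

  commonRefinements-empty : (σ π : Lab 0) → commonRefinements σ π ≈ 1#
  commonRefinements-empty [] [] = trans
    (∑ₚ-cong {0} λ { [] → trans (*-cong (𝟙-yes ([] ⊑? []) (⊑-refl [])) (𝟙-yes ([] ⊑? []) (⊑-refl [])))
                                (trans (*-identityˡ 1#) (sym (𝟙-yes ([] ≅? []) (≅-refl [])))) })
    (∑ₚ-δ-one [])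

  pairing : (Lab n → Lab n → Carrier) → FSum K n → FSum K n → Carrier
  pairing M x y = ∑[ p ∈ x ] ∑[ q ∈ y ] (proj₁ p * proj₁ q * M (proj₂ p) (proj₂ q))

  ev-pairing : (M : Lab n → Lab n → Carrier) (x y : FSum K n) → ev K M x y ≡ pairing M x y
  ev-pairing M []      y = ≡.refl
  ev-pairing M (p ∷ x) y = ≡.cong₂ _+_ (row y) (ev-pairing M x y)
    where
    row : ∀ y → foldr (λ { (b , π) r → proj₁ p * b * M (proj₂ p) π + r }) 0# y ≡
                ∑[ q ∈ y ] (proj₁ p * proj₁ q * M (proj₂ p) (proj₂ q))
    row []      = ≡.refl
    row (q ∷ y) = ≡.cong (_ +_) (row y)

  pairing₂ : (Lab k → Lab k → Carrier) → (Lab l → Lab l → Carrier) → TSum K k l → TSum K k l → Carrier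
  pairing₂ M N w u = ∑[ p ∈ w ] ∑[ q ∈ u ]
    (proj₁ p * proj₁ q * (M (proj₁ (proj₂ p)) (proj₁ (proj₂ q)) * N (proj₂ (proj₂ p)) (proj₂ (proj₂ q))))

  evT-pairing₂ : (M : Lab k → Lab k → Carrier) (N : Lab l → Lab l → Carrier) (w u : TSum K k l) →
    evT K M N w u ≡ pairing₂ M N w u
  evT-pairing₂ M N []      u = ≡.refl
  evT-pairing₂ M N (p ∷ w) u = ≡.cong₂ _+_ (row u) (evT-pairing₂ M N w u)
    where
    row : ∀ u →
      foldr (λ { (b , σ , τ) r → proj₁ p * b * (M (proj₁ (proj₂ p)) σ * N (proj₂ (proj₂ p)) τ) + r }) 0# u ≡
      ∑[ q ∈ u ] (proj₁ p * proj₁ q * (M (proj₁ (proj₂ p)) (proj₁ (proj₂ q)) * N (proj₂ (proj₂ p)) (proj₂ (proj₂ q))))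
    row []      = ≡.refl
    row (q ∷ u) = ≡.cong (_ +_) (row u)

  pairing-μ : (s : Split n k l) (w : TSum K k l) (z : FSum K n) →
    pairing commonRefinements (μ K s w) z ≈ pairing₂ commonRefinements commonRefinements w (Δ K s z)
  pairing-μ s w z = begin
    pairing commonRefinements (μ K s w) z
      ≡⟨ ∑-map _ w _ ⟩
    ∑[ p ∈ w ] ∑[ q ∈ z ]
      (proj₁ p * proj₁ q * commonRefinements (union s (proj₁ (proj₂ p)) (proj₂ (proj₂ p))) (proj₂ q))
      ≈⟨ ∑-cong w (λ p → ∑-cong z λ q → *-congˡ (commonRefinements-union s _ _ (proj₂ q))) ⟩
    ∑[ p ∈ w ] ∑[ q ∈ z ] (proj₁ p * proj₁ q * (commonRefinements (proj₁ (proj₂ p)) (restrL s (proj₂ q))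
                                                * commonRefinements (proj₂ (proj₂ p)) (restrR s (proj₂ q))))
      ≈⟨ ∑-cong w (λ p → reflexive (≡.sym (∑-map _ z _))) ⟩
    pairing₂ commonRefinements commonRefinements w (Δ K s z) ∎

  pairing-Δ : (s : Split n k l) (z : FSum K n) (u : TSum K k l) →
    pairing commonRefinements z (μ K s u) ≈ pairing₂ commonRefinements commonRefinements (Δ K s z) u
  pairing-Δ s z u = begin
    pairing commonRefinements z (μ K s u)
      ≈⟨ ∑-cong z (λ p → reflexive (∑-map _ u _)) ⟩
    ∑[ p ∈ z ] ∑[ q ∈ u ]
      (proj₁ p * proj₁ q * commonRefinements (proj₂ p) (union s (proj₁ (proj₂ q)) (proj₂ (proj₂ q))))
      ≈⟨ ∑-cong z (λ p → ∑-cong u λ q → *-congˡ (factor (proj₂ p) (proj₁ (proj₂ q)) (proj₂ (proj₂ q)))) ⟩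
    ∑[ p ∈ z ] ∑[ q ∈ u ] (proj₁ p * proj₁ q * (commonRefinements (restrL s (proj₂ p)) (proj₁ (proj₂ q))
                                                * commonRefinements (restrR s (proj₂ p)) (proj₂ (proj₂ q))))
      ≡⟨ ∑-map _ z _ ⟨
    pairing₂ commonRefinements commonRefinements (Δ K s z) u ∎
    where
    factor : ∀ π σ τ → commonRefinements π (union s σ τ) ≈
                       commonRefinements (restrL s π) σ * commonRefinements (restrR s π) τ
    factor π σ τ = trans (commonRefinements-sym π _) (trans (commonRefinements-union s σ τ π)
      (*-cong (commonRefinements-sym σ _) (commonRefinements-sym τ _)))

  ε-∑ : (z : FSum K 0) → ε K z ≡ ∑[ p ∈ z ] proj₁ p
  ε-∑ []      = ≡.refl
  ε-∑ (p ∷ z) = ≡.cong (proj₁ p +_) (ε-∑ z)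

  pairing-unit : (z : FSum K 0) →
    (pairing commonRefinements (η K 1#) z ≈ ε K z) × (pairing commonRefinements z (η K 1#) ≈ ε K z)
  pairing-unit z =
    trans (+-identityʳ _) (trans (∑-cong z λ q → trans (scalar _ [] (proj₂ q)) (*-identityˡ _)) (ε≡∑ z)) ,
    trans (∑-cong z λ p → trans (+-identityʳ _) (trans (scalar _ (proj₂ p) []) (*-identityʳ _))) (ε≡∑ z)
    where
    scalar : ∀ x (σ π : Lab 0) → x * commonRefinements σ π ≈ x
    scalar x σ π = trans (*-congˡ (commonRefinements-empty σ π)) (*-identityʳ x)
    ε≡∑ : ∀ z → ∑[ p ∈ z ] proj₁ p ≈ ε K z
    ε≡∑ z = reflexive (≡.sym (ε-∑ z))

  module Unitriangular {n} (_≺_ : Lab n → Lab n → Set) (_≺?_ : ∀ a b → Dec (a ≺ b))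
                       (height : Lab n → ℕ) (height-< : ∀ {a b} → a ≺ b → height a < height b) where

    below : (Lab n → Carrier) → Lab n → Carrier
    below c a = ∑[ b ⊢ n ] (𝟙 (b ≺? a) * c b)

    ≺-wellFounded : WellFounded _≺_
    ≺-wellFounded = Subrelation.wellFounded height-< (On.wellFounded height ℕ.<-wellFounded)

    induction : (Q : Lab n → Set ℓ) → (∀ a → (∀ b → b ≺ a → Q b) → Q a) → ∀ a → Q a
    induction Q step = WF.All.wfRec ≺-wellFounded ℓ Q λ a rec → step a λ b b≺a → rec b≺a

    below-zero : {c : Lab n → Carrier} {a : Lab n} → (∀ b → b ≺ a → c b ≈ 0#) → below c a ≈ 0#
    below-zero {a = a} h = ∑ₚ-zero {n} λ b → 𝟙-*-zero (b ≺? a) (h b)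

    -- Iterating c ↦ g - below c: the value at a is final after height a + 1 rounds.
    iterate : (Lab n → Carrier) → ℕ → Lab n → Carrier
    iterate g zero    a = 0#
    iterate g (suc t) a = g a - below (iterate g t) a

    below-iterate-stable : ∀ g t a → (∀ b → b ≺ a → height b < t) →
      below (iterate g (suc t)) a ≈ below (iterate g t) a
    below-iterate-stable g t a h = ∑ₚ-cong {n} λ b → 𝟙-*-cong (b ≺? a) λ b≺a → iterate-stable t b (h b b≺a)
      where
      iterate-stable : ∀ t b → height b < t → iterate g (suc t) b ≈ iterate g t b
      iterate-stable (suc t) b lt = +-congˡ (-‿cong (below-iterate-stable g t b
        λ b′ b′≺b → ℕ.<-≤-trans (height-< b′≺b) (ℕ.≤-pred lt)))

    solve : (g : Lab n → Carrier) (B : ℕ) → (∀ a → height a ≤ B) →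
      Σ (Lab n → Carrier) λ c → ∀ a → c a + below c a ≈ g a
    solve g B bounded = iterate g (suc B) , λ a → begin
      (g a - below (iterate g B) a) + below (iterate g (suc B)) a
        ≈⟨ +-congˡ (below-iterate-stable g B a λ b b≺a → ℕ.<-≤-trans (height-< b≺a) (bounded a)) ⟩
      (g a - below (iterate g B) a) + below (iterate g B) a
        ≈⟨ +-assoc _ _ _ ⟩
      g a + (- below (iterate g B) a + below (iterate g B) a)
        ≈⟨ +-congˡ (-‿inverseˡ _) ⟩
      g a + 0#
        ≈⟨ +-identityʳ _ ⟩
      g a ∎

  ∑ₚ-⊑-split : (π : Lab n) (c : Lab n → Carrier) →
    ∑[ α ⊢ n ] (𝟙 (α ⊑? π) * c α) ≈ ∑[ α ⊢ n ] (𝟙 (α ≅? π) * c α) + ∑[ α ⊢ n ] (𝟙 (α ⊏? π) * c α)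
  ∑ₚ-⊑-split {n} π c = trans (∑ₚ-cong {n} λ α → trans (*-congʳ (𝟙-split (α ⊑? π) (π ⊑? α))) (distribʳ _ _ _))
                             (∑ₚ-distrib-+ _ _)

  ∑ₚ-⊒-split : (α : Lab n) (c : Lab n → Carrier) →
    ∑[ ρ ⊢ n ] (𝟙 (α ⊑? ρ) * c ρ) ≈ ∑[ ρ ⊢ n ] (𝟙 (ρ ≅? α) * c ρ) + ∑[ ρ ⊢ n ] (𝟙 (α ⊏? ρ) * c ρ)
  ∑ₚ-⊒-split {n} α c = trans (∑ₚ-cong {n} λ ρ → trans (*-congʳ (trans (𝟙-split (α ⊑? ρ) (ρ ⊑? α))
                               (+-congʳ (𝟙-⇔ (α ≅? ρ) (ρ ≅? α) (mk⇔ ≅-sym ≅-sym))))) (distribʳ _ _ _))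
                             (∑ₚ-distrib-+ _ _)

  -- The coefficient of p_α in x, since m_σ = Σ_{α ⊑ σ} p_α.
  pCoeff : FSum K n → Lab n → Carrier
  pCoeff x α = linear (λ σ → 𝟙 (α ⊑? σ)) x

  pCoeff-invariant : (x : FSum K n) → Invariant (pCoeff x)
  pCoeff-invariant x e = linear-cong x λ σ → ⊑-invariantˡ σ e

  pCoeff-coeff : (x : FSum K n) (α : Lab n) → pCoeff x α ≈ ∑[ ρ ⊢ n ] (𝟙 (α ⊑? ρ) * coeff K ρ x)
  pCoeff-coeff x α = linear-coeff x _ (⊑-invariantʳ α)

  pCoeff-unstable : (G : Graph n) (x : FSum K n) → AllStable K G x → {α : Lab n} → ¬ Stable G α → pCoeff x α ≈ 0#
  pCoeff-unstable G []            []             α-unstable = refl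
  pCoeff-unstable G ((b , σ) ∷ x) (σ-stable ∷ st) {α} α-unstable =
    trans (+-cong (trans (*-congˡ (𝟙-no (α ⊑? σ) λ α⊑σ → α-unstable (stable-⊑ G α⊑σ σ-stable))) (zeroʳ b))
                  (pCoeff-unstable G x st α-unstable))
          (+-identityʳ 0#)

  pairing-m : (x : FSum K n) (π : Lab n) →
    pairing commonRefinements x ((1# , π) ∷ []) ≈ ∑[ α ⊢ n ] (𝟙 (α ⊑? π) * pCoeff x α)
  pairing-m {n} x π = begin
    ∑[ p ∈ x ] (proj₁ p * 1# * commonRefinements (proj₂ p) π + 0#)
      ≈⟨ ∑-cong x (λ p → trans (+-identityʳ _) (*-congʳ (*-identityʳ _))) ⟩
    ∑[ p ∈ x ] (proj₁ p * commonRefinements (proj₂ p) π)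
      ≈⟨ ∑-cong x (λ p → *-∑ₚ (proj₁ p) _) ⟩
    ∑[ p ∈ x ] ∑[ α ⊢ n ] (proj₁ p * (𝟙 (α ⊑? proj₂ p) * 𝟙 (α ⊑? π)))
      ≈⟨ ∑-∑ₚ-comm x _ ⟩
    ∑[ α ⊢ n ] ∑[ p ∈ x ] (proj₁ p * (𝟙 (α ⊑? proj₂ p) * 𝟙 (α ⊑? π)))
      ≈⟨ ∑ₚ-cong {n} (λ α → trans (∑-cong x λ p → x∙yz≈z∙xy _ _ _) (sym (*-∑ x _ _))) ⟩
    ∑[ α ⊢ n ] (𝟙 (α ⊑? π) * pCoeff x α) ∎

  pairing-m-invariant : (x : FSum K n) {π π′ : Lab n} → π ≅ π′ →
    pairing commonRefinements x ((1# , π) ∷ []) ≈ pairing commonRefinements x ((1# , π′) ∷ [])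
  pairing-m-invariant {n} x {π} {π′} e = trans (pairing-m x π)
    (trans (∑ₚ-cong {n} λ α → *-congʳ (⊑-invariantʳ α e)) (sym (pairing-m x π′)))

  module Down {n : ℕ} = Unitriangular {n} _⊏_ _⊏?_ blockPairs blockPairs-mono-<

  module Up {n : ℕ} = Unitriangular {n} (λ b a → a ⊏ b) (λ b a → a ⊏? b) coBlockPairs coBlockPairs-mono-<

  module UpStable {n : ℕ} (G : Graph n) = Unitriangular {n} (λ b a → Stable G b × a ⊏ b)
    (λ b a → stable? G b ×-dec a ⊏? b) coBlockPairs (coBlockPairs-mono-< ∘ proj₂)

  pairing-nondegenerate : (G : Graph n) (x : FSum K n) → AllStable K G x →
    (∀ π → Stable G π → pairing commonRefinements x ((1# , π) ∷ []) ≈ 0#) → ∀ π → coeff K π x ≈ 0#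
  pairing-nondegenerate {n} G x x-stable orthogonal = Up.induction _ coeff-zero
    where
    pCoeff-zero : ∀ α → pCoeff x α ≈ 0#
    pCoeff-zero = Down.induction _ step
      where
      step : ∀ α → (∀ β → β ⊏ α → pCoeff x β ≈ 0#) → pCoeff x α ≈ 0#
      step α ih with stable? G α
      ... | no  α-unstable = pCoeff-unstable G x x-stable α-unstable
      ... | yes α-stable   = begin
        pCoeff x α
          ≈⟨ +-identityʳ _ ⟨
        pCoeff x α + 0#
          ≈⟨ +-cong (∑ₚ-δ-invariant α (pCoeff x) (pCoeff-invariant x)) (Down.below-zero ih) ⟨
        ∑[ β ⊢ n ] (𝟙 (β ≅? α) * pCoeff x β) + ∑[ β ⊢ n ] (𝟙 (β ⊏? α) * pCoeff x β)
          ≈⟨ ∑ₚ-⊑-split α (pCoeff x) ⟨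
        ∑[ β ⊢ n ] (𝟙 (β ⊑? α) * pCoeff x β)
          ≈⟨ pairing-m x α ⟨
        pairing commonRefinements x ((1# , α) ∷ [])
          ≈⟨ orthogonal α α-stable ⟩
        0# ∎
    coeff-zero : ∀ α → (∀ ρ → α ⊏ ρ → coeff K ρ x ≈ 0#) → coeff K α x ≈ 0#
    coeff-zero α ih = begin
      coeff K α x
        ≈⟨ +-identityʳ _ ⟨
      coeff K α x + 0#
        ≈⟨ +-cong (∑ₚ-δ-invariant α (λ ρ → coeff K ρ x) (coeff-invariant x)) (Up.below-zero ih) ⟨
      ∑[ ρ ⊢ n ] (𝟙 (ρ ≅? α) * coeff K ρ x) + ∑[ ρ ⊢ n ] (𝟙 (α ⊏? ρ) * coeff K ρ x)
        ≈⟨ ∑ₚ-⊒-split α (λ ρ → coeff K ρ x) ⟨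
      ∑[ ρ ⊢ n ] (𝟙 (α ⊑? ρ) * coeff K ρ x)
        ≈⟨ pCoeff-coeff x α ⟨
      pCoeff x α
        ≈⟨ pCoeff-zero α ⟩
      0# ∎

  ∑-filter : {Q : A → Set q} (Q? : ∀ x → Dec (Q x)) (xs : List A) (F : A → Carrier) →
    ∑ (filter Q? xs) F ≈ ∑[ x ∈ xs ] (𝟙 (Q? x) * F x)
  ∑-filter Q? []       F = refl
  ∑-filter Q? (x ∷ xs) F with Q? x
  ... | yes q = +-cong (sym (trans (*-congʳ (𝟙-yes (yes q) q)) (*-identityˡ _))) (∑-filter Q? xs F)
  ... | no ¬q = trans (∑-filter Q? xs F)
                      (sym (trans (+-congʳ (𝟙-*-zero (no ¬q) λ q → contradiction q ¬q)) (+-identityˡ _)))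

  opaque
    unfolding ∑ₚ

    ∑-canonical-filter : {Q : Lab n → Set q} (Q? : ∀ α → Dec (Q α)) (F : Lab n → Carrier) →
      ∑ (filter (λ v → canonical? v ×-dec Q? v) (vectors n n)) F ≈ ∑[ α ⊢ n ] (𝟙 (Q? α) * F α)
    ∑-canonical-filter {n} Q? F = trans (∑-filter _ (vectors n n) F)
      (∑-cong (vectors n n) λ v → trans (*-congʳ (𝟙-× (canonical? v) (Q? v))) (*-assoc _ _ _))

  -- Solve first for the p-coefficients cₚ (Σ_{α ⊑ π} cₚ α = f π), then for coefficients cₘ of
  -- stable partitions in the m-basis (Σ_{σ stable, α ⊑ σ} cₘ σ = cₚ α); both systems are unitriangular.
  pairing-surjective : (G : Graph n) (f : Lab n → Carrier) → (∀ {π π′} → Stable G π → π ≅ π′ → f π ≈ f π′) →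
    Σ (FSum K n) λ x → AllStable K G x × (∀ π → Stable G π → pairing commonRefinements x ((1# , π) ∷ []) ≈ f π)
  pairing-surjective {n} G f f-invariant = x , x-stable , value
    where
    cₚ : Lab n → Carrier
    cₚ = proj₁ (Down.solve f (n ℕ.* n) blockPairs-≤)
    cₘ : Lab n → Carrier
    cₘ = proj₁ (UpStable.solve G cₚ (n ℕ.* n) coBlockPairs-≤)
    representatives : List (Lab n)
    representatives = filter (λ v → canonical? v ×-dec stable? G v) (vectors n n)
    x : FSum K n
    x = map (λ σ → cₘ σ , σ) representatives
    x-stable : AllStable K G x
    x-stable = All.map⁺ (All.map proj₂ (All.all-filter (λ v → canonical? v ×-dec stable? G v) (vectors n n)))
    pCoeff-x : ∀ α → IsCanonical α → Stable G α → pCoeff x α ≈ cₚ α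
    pCoeff-x α α-canonical α-stable = begin
      pCoeff x α
        ≡⟨ ∑-map _ representatives _ ⟩
      ∑[ σ ∈ representatives ] (cₘ σ * 𝟙 (α ⊑? σ))
        ≈⟨ ∑-canonical-filter (stable? G) _ ⟩
      ∑[ σ ⊢ n ] (𝟙 (stable? G σ) * (cₘ σ * 𝟙 (α ⊑? σ)))
        ≈⟨ ∑ₚ-cong {n} (λ σ → x∙yz≈z∙xy _ _ _) ⟩
      ∑[ σ ⊢ n ] (𝟙 (α ⊑? σ) * cₘ′ σ)
        ≈⟨ ∑ₚ-⊒-split α cₘ′ ⟩
      ∑[ σ ⊢ n ] (𝟙 (σ ≅? α) * cₘ′ σ) + ∑[ σ ⊢ n ] (𝟙 (α ⊏? σ) * cₘ′ σ)
        ≈⟨ +-cong (sym (∑ₚ-δ-canonical α cₘ′ α-canonical))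
                  (∑ₚ-cong {n} λ σ → trans (*-congʳ (𝟙-× (stable? G σ) (α ⊏? σ))) (xy∙z≈y∙xz _ _ _)) ⟨
      cₘ′ α + UpStable.below G cₘ α
        ≈⟨ +-congʳ (trans (*-congʳ (𝟙-yes (stable? G α) α-stable)) (*-identityˡ _)) ⟩
      cₘ α + UpStable.below G cₘ α
        ≈⟨ proj₂ (UpStable.solve G cₚ (n ℕ.* n) coBlockPairs-≤) α ⟩
      cₚ α ∎
      where
      cₘ′ : Lab n → Carrier
      cₘ′ σ = 𝟙 (stable? G σ) * cₘ σ
    value-canonical : ∀ π → IsCanonical π → Stable G π → pairing commonRefinements x ((1# , π) ∷ []) ≈ f π
    value-canonical π π-canonical π-stable = begin
      pairing commonRefinements x ((1# , π) ∷ [])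
        ≈⟨ pairing-m x π ⟩
      ∑[ α ⊢ n ] (𝟙 (α ⊑? π) * pCoeff x α)
        ≈⟨ ∑ₚ-cong-canonical {n} (λ α α-canonical → 𝟙-*-cong (α ⊑? π) λ α⊑π →
             pCoeff-x α α-canonical (stable-⊑ G α⊑π π-stable)) ⟩
      ∑[ α ⊢ n ] (𝟙 (α ⊑? π) * cₚ α)
        ≈⟨ ∑ₚ-⊑-split π cₚ ⟩
      ∑[ α ⊢ n ] (𝟙 (α ≅? π) * cₚ α) + Down.below cₚ π
        ≈⟨ +-congʳ (∑ₚ-δ-canonical π cₚ π-canonical) ⟩
      cₚ π + Down.below cₚ π
        ≈⟨ proj₂ (Down.solve f (n ℕ.* n) blockPairs-≤) π ⟩
      f π ∎
    value : ∀ π → Stable G π → pairing commonRefinements x ((1# , π) ∷ []) ≈ f π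
    value π π-stable = begin
      pairing commonRefinements x ((1# , π) ∷ [])
        ≈⟨ pairing-m-invariant x (canon-≅ π) ⟩
      pairing commonRefinements x ((1# , canon π) ∷ [])
        ≈⟨ value-canonical (canon π) (canon-canonical π) (stable-⊑ G (proj₂ (canon-≅ π)) π-stable) ⟩
      f (canon π)
        ≈⟨ f-invariant π-stable (canon-≅ π) ⟨
      f π ∎

  isSelfDual : IsSelfDual K
  isSelfDual = (λ _ → commonRefinements)
             , (λ G σ σ′ π π′ _ _ e e′ → commonRefinements-cong (Equivalence.to T-~ᵇ e) (Equivalence.to T-~ᵇ e′))
             , (λ G G′ ρ _ σ π _ _ → commonRefinements-relabel ρ σ π)
             , injective
             , surjective
             , (λ G s w z _ _ → via-pairing₂ (μ K s w) z w (Δ K s z) (pairing-μ s w z))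
             , (λ G s z u _ _ → via-pairing₂ z (μ K s u) (Δ K s z) u (pairing-Δ s z u))
             , (λ G z _ → via-pairing (η K 1#) z (proj₁ (pairing-unit z))
                        , via-pairing z (η K 1#) (proj₂ (pairing-unit z)))
    where
    via-pairing : (x y : FSum K n) {r : Carrier} →
      pairing commonRefinements x y ≈ r → ev K commonRefinements x y ≈ r
    via-pairing x y = trans (reflexive (ev-pairing commonRefinements x y))
    via-pairing₂ : (x y : FSum K n) (w u : TSum K k l) →
      pairing commonRefinements x y ≈ pairing₂ commonRefinements commonRefinements w u →
      ev K commonRefinements x y ≈ evT K commonRefinements commonRefinements w u
    via-pairing₂ x y w u p = via-pairing x y (trans p (reflexive (≡.sym (evT-pairing₂ _ _ w u))))
    injective : ∀ {n} (G : Graph n) (x : FSum K n) → AllStable K G x →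
      (∀ y → AllStable K G y → ev K commonRefinements x y ≈ 0#) → _≋_ K x []
    injective G x x-stable orthogonal = pairing-nondegenerate G x x-stable λ π π-stable →
      trans (reflexive (≡.sym (ev-pairing commonRefinements x ((1# , π) ∷ [])))) (orthogonal _ (π-stable ∷ []))
    surjective : ∀ {n} (G : Graph n) (f : Lab n → Carrier) → (∀ π π′ → Stable G π → π ~ π′ → f π ≈ f π′) →
      Σ (FSum K n) λ x → AllStable K G x × (∀ π → Stable G π → ev K commonRefinements x ((1# , π) ∷ []) ≈ f π)
    surjective G f f-invariant =
      let (x , x-stable , value) =
            pairing-surjective G f λ π-stable e → f-invariant _ _ π-stable (Equivalence.from T-~ᵇ e)
      in x , x-stable , λ π π-stable → via-pairing x ((1# , π) ∷ []) (value π π-stable)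

open Linear

mainTheorem9 : ∀ {c ℓ} (K : Field c ℓ) →
    IsHopfSubmonoid K × IsCommutative K × IsCocommutative K × IsSelfDual K
mainTheorem9 K = isHopfSubmonoid K , isCommutative K , isCocommutative K , isSelfDual K
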